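{- Let $\mathbb X$ be a basic set and $Z\subseteq\mathbb X$. Then $Z$ is constructively immune if and only if $Z$ is infinite and its complement $\mathbb X\setminus Z$ is constructively $\Sigma^0_1$-dense.
   Context: A basic set is a finite product of $\mathbb N$, $\mathbb Z$, $\Sigma^*$. Let $(W_i)_{i\in\mathbb N}$ be an acceptable enumeration of the r.e. subsets of $\mathbb X$. A set $X\subseteq\mathbb X$ is constructively immune if it is infinite and there is a partial recursive $\varphi:\mathbb N\to\mathbb X$ such that for all $i$, if $W_i$ is infinite then $\varphi(i)$ is defined and $\varphi(i)\in W_i\setminus X$. A set $Y\subseteq\mathbb X$ is constructively $\Sigma^0_1$-dense if there is a total recursive $\lambda$ such that for all $i$, if $W_i$ is infinite then $W_{\lambda(i)}$ is an infinite subset of $Y\cap W_i$. -}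

module Defs where

open import Data.Nat using (ℕ; zero; suc; _+_; _*_; _<_)
open import Data.Fin using (Fin; toℕ)
open import Data.Vec using (Vec; []; _∷_; lookup)
open import Data.List using (List; []; _∷_)
open import Data.List.Membership.Propositional using (_∈_)
open import Data.Integer using (ℤ; +_; -[1+_])
open import Data.Product using (Σ; ∃; _×_; _,_)
open import Data.Unit using (⊤; tt)
open import Relation.Nullary using (¬_)
open import Relation.Binary.PropositionalEquality using (_≡_)

-- Partial recursive functions: μ-recursive terms with a big-step
-- (relational, hence partial) semantics.

data PR : ℕ → Set where
  zer  : ∀ {n} → PR n
  succ : PR 1
  proj : ∀ {n} → Fin n → PR n
  comp : ∀ {k n} → PR k → Vec (PR n) k → PR n
  prec : ∀ {n} → PR n → PR (suc (suc n)) → PR (suc n)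
  mu   : ∀ {n} → PR (suc n) → PR n

mutual
  data Eval : ∀ {n} → PR n → Vec ℕ n → ℕ → Set where
    ev-zer  : ∀ {n} {xs : Vec ℕ n} → Eval zer xs 0
    ev-succ : ∀ {x} → Eval succ (x ∷ []) (suc x)
    ev-proj : ∀ {n} {i : Fin n} {xs} → Eval (proj i) xs (lookup xs i)
    ev-comp : ∀ {k n} {f : PR k} {gs : Vec (PR n) k} {xs ys y} →
              EvalVec gs xs ys → Eval f ys y → Eval (comp f gs) xs y
    ev-prec0 : ∀ {n} {f : PR n} {g} {xs y} →
               Eval f xs y → Eval (prec f g) (0 ∷ xs) y
    ev-precS : ∀ {n} {f : PR n} {g} {x xs r y} →
               Eval (prec f g) (x ∷ xs) r → Eval g (x ∷ r ∷ xs) y →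
               Eval (prec f g) (suc x ∷ xs) y
    ev-mu   : ∀ {n} {f : PR (suc n)} {xs y} →
              Eval f (y ∷ xs) 0 →
              (∀ z → z < y → Σ ℕ (λ v → Eval f (z ∷ xs) (suc v))) →
              Eval (mu f) xs y

  data EvalVec : ∀ {k n} → Vec (PR n) k → Vec ℕ n → Vec ℕ k → Set where
    []  : ∀ {n} {xs : Vec ℕ n} → EvalVec [] xs []
    _∷_ : ∀ {k n} {g : PR n} {gs : Vec (PR n) k} {xs y ys} →
          Eval g xs y → EvalVec gs xs ys → EvalVec (g ∷ gs) xs (y ∷ ys)

tri : ℕ → ℕ
tri zero    = 0
tri (suc n) = suc n + tri n

pair : ℕ → ℕ → ℕ
pair a b = tri (a + b) + b

mutual
  encode : ∀ {n} → PR n → ℕ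
  encode (zer {n})          = pair 0 n
  encode succ               = pair 1 0
  encode (proj {n} i)       = pair 2 (pair n (toℕ i))
  encode (comp {k} {n} f gs) = pair 3 (pair (pair k n) (pair (encode f) (encodeVec gs)))
  encode (prec {n} f g)     = pair 4 (pair n (pair (encode f) (encode g)))
  encode (mu {n} f)         = pair 5 (pair n (encode f))

  encodeVec : ∀ {k n} → Vec (PR n) k → ℕ
  encodeVec []       = 0
  encodeVec (g ∷ gs) = suc (pair (encode g) (encodeVec gs))

-- Basic sets: finite products of ℕ, ℤ, Σ* where Σ = Fin (suc k)
-- is a (nonempty) finite alphabet.

data Sort : Set where
  Nat Int Str : Sort

⟦_⟧ : Sort → ℕ → Set
⟦ Nat ⟧ k = ℕ
⟦ Int ⟧ k = ℤ
⟦ Str ⟧ k = List (Fin (suc k))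

El : ℕ → List Sort → Set
El k []       = ⊤
El k (s ∷ ss) = ⟦ s ⟧ k × El k ss

codeℤ : ℤ → ℕ
codeℤ (+ n)     = 2 * n
codeℤ -[1+ n ]  = suc (2 * n)

codeStr : ∀ {k} → List (Fin (suc k)) → ℕ
codeStr []       = 0
codeStr (c ∷ w)  = suc (pair (toℕ c) (codeStr w))

codeSort : ∀ {k} s → ⟦ s ⟧ k → ℕ
codeSort Nat n = n
codeSort Int z = codeℤ z
codeSort Str w = codeStr w

code : ∀ {k} X → El k X → ℕ
code []       tt       = 0
code (s ∷ ss) (a , as) = pair (codeSort s a) (code ss as)

-- The acceptable enumeration (W_i) of r.e. subsets of X:
-- W_i = { x ∈ X | φ_i(code x) halts }, φ_i the unary partial recursive
-- function with Gödel number i (empty function if i codes no unary term).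

W : (k : ℕ) (X : List Sort) → ℕ → El k X → Set
W k X i x = Σ (PR 1) λ t → encode t ≡ i × Σ ℕ λ y → Eval t (code X x ∷ []) y

Finite : {A : Set} → (A → Set) → Set
Finite {A} P = Σ (List A) λ xs → ∀ x → P x → x ∈ xs

Infinite : {A : Set} → (A → Set) → Set
Infinite P = ¬ Finite P

complement : {A : Set} → (A → Set) → A → Set
complement P x = ¬ P x

ConstructivelyImmune : (k : ℕ) (X : List Sort) → (El k X → Set) → Set
ConstructivelyImmune k X Z =
  Infinite Z ×
  Σ (PR 1) λ t → ∀ i → Infinite (W k X i) →
    Σ (El k X) λ x → Eval t (i ∷ []) (code X x) × W k X i x × ¬ Z x

ConstructivelyDense : (k : ℕ) (X : List Sort) → (El k X → Set) → Set
ConstructivelyDense k X Y =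
  Σ (PR 1) λ t →
    (∀ i → Σ ℕ λ j → Eval t (i ∷ []) j) ×
    (∀ i → Infinite (W k X i) → ∀ j → Eval t (i ∷ []) j →
       Infinite (W k X j) × (∀ x → W k X j x → Y x × W k X i x))

-- Both directions rest on a primitive recursive certificate checker: a certificate is a coded list of
-- evaluation judgements, each justified by later entries, and the checker is sound and complete for
-- Eval.  Membership  x ∈ W_i  thus becomes  ∃ cert. certifies i (code x) cert,  open to μ-search.
-- (⇐) φ(i) is the first x found in W_λ(i) by such a search: W_λ(i) is infinite, hence inhabited
--     (excluded middle), and W_λ(i) ⊆ W_i ∖ Z.
-- (⇒) An index of W_i ∖ L, for a finite list L, is primitive recursive in i and L (an s-m-n step), so
--     x_n = φ(index of W_i ∖ {x_0, …, x_{n-1}}) is computable in n.  For infinite W_i these are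
--     distinct elements of W_i ∖ Z, and λ(i) indexes {x_n | n ∈ ℕ}, infinite by pigeonhole.

module Submission where

open import Axiom.ExcludedMiddle using (ExcludedMiddle)
open import Data.Empty using (⊥; ⊥-elim)
open import Data.Fin using (Fin; zero; suc; toℕ; fromℕ<)
open import Data.Fin.Properties using (toℕ-fromℕ<; toℕ-injective; toℕ<n; pigeonhole)
open import Data.Integer as ℤ using (ℤ; -[1+_])
open import Data.List using (List; []; _∷_; length; map; _++_; drop)
open import Data.List.Properties using (length-drop; drop-[]; drop-all; map-injective)
open import Data.List.Membership.Propositional using (_∈_; _∉_)
open import Data.List.Membership.Propositional.Properties using (∈-++⁺ˡ; ∈-++⁺ʳ; ∈-map⁻)
open import Data.List.Relation.Binary.Subset.Propositional using (_⊆_)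
open import Data.List.Relation.Unary.Any using (here; there; index)
open import Data.List.Relation.Unary.Any.Properties using (lookup-index)
open import Data.Nat using (ℕ; zero; suc; pred; _+_; _∸_; _<_; _≤_; z≤n; s≤s)
open import Data.Nat.Properties
open import Data.Product using (Σ; _×_; _,_; proj₁; proj₂)
open import Data.Sum using (_⊎_; inj₁; inj₂)
open import Data.Unit using (tt)
open import Data.Vec using (Vec; []; _∷_; lookup; fromList; toList; tabulate)
open import Data.Vec.Properties using (tabulate∘lookup)
open import Defs
open import Function using (_$_; _∘_; id)
open import Function.Bundles using (_⇔_; mk⇔)
open import Level using (0ℓ)
open import Relation.Binary using (tri<; tri≈; tri>)
open import Relation.Binary.PropositionalEquality
open import Relation.Nullary using (¬_; yes; no)

record Computable (n : ℕ) (F : Vec ℕ n → ℕ) : Set where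
  constructor computable
  field
    term : PR n
    evaluates : ∀ xs → Eval term xs (F xs)
open Computable public

data Expr (n : ℕ) : Set where
  var  : Fin n → Expr n
  call : ∀ {k} {F : Vec ℕ k → ℕ} → Computable k F → Vec (Expr n) k → Expr n

mutual
  ⟪_⟫ : ∀ {n} → Expr n → Vec ℕ n → ℕ
  ⟪ var i ⟫ xs = lookup xs i
  ⟪ call {F = F} p es ⟫ xs = F (⟪ es ⟫* xs)

  ⟪_⟫* : ∀ {n k} → Vec (Expr n) k → Vec ℕ n → Vec ℕ k
  ⟪ [] ⟫* xs = []
  ⟪ e ∷ es ⟫* xs = ⟪ e ⟫ xs ∷ ⟪ es ⟫* xs

mutual
  compile : ∀ {n} → Expr n → PR n
  compile (var i) = proj i
  compile (call p es) = comp (term p) (compile* es)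

  compile* : ∀ {n k} → Vec (Expr n) k → Vec (PR n) k
  compile* [] = []
  compile* (e ∷ es) = compile e ∷ compile* es

mutual
  compile-eval : ∀ {n} (e : Expr n) xs → Eval (compile e) xs (⟪ e ⟫ xs)
  compile-eval (var i) xs = ev-proj
  compile-eval (call p es) xs = ev-comp (compile*-eval es xs) (evaluates p _)

  compile*-eval : ∀ {n k} (es : Vec (Expr n) k) xs → EvalVec (compile* es) xs (⟪ es ⟫* xs)
  compile*-eval [] xs = []
  compile*-eval (e ∷ es) xs = compile-eval e xs ∷ compile*-eval es xs

resp-≗ : ∀ {n F G} → Computable n F → F ≗ G → Computable n G
resp-≗ p eq = computable (term p) (λ xs → subst (Eval (term p) xs) (eq xs) (evaluates p xs))

fromExpr : ∀ {n} {F : Vec ℕ n → ℕ} (e : Expr n) → ⟪ e ⟫ ≗ F → Computable n F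
fromExpr e = resp-≗ (computable (compile e) (compile-eval e))

primRec : ∀ {n} → (Vec ℕ n → ℕ) → (Vec ℕ (suc (suc n)) → ℕ) → Vec ℕ (suc n) → ℕ
primRec F G (zero ∷ xs) = F xs
primRec F G (suc x ∷ xs) = G (x ∷ primRec F G (x ∷ xs) ∷ xs)

primRecᶜ : ∀ {n F G} → Computable n F → Computable (suc (suc n)) G → Computable (suc n) (primRec F G)
primRecᶜ {n} {F} {G} pf pg = computable (prec (term pf) (term pg)) go
  where
  go : ∀ xs → Eval (prec (term pf) (term pg)) xs (primRec F G xs)
  go (zero ∷ xs) = ev-prec0 (evaluates pf xs)
  go (suc x ∷ xs) = ev-precS (go (x ∷ xs)) (evaluates pg _)

numeral : ∀ {n} → ℕ → PR n
numeral zero = zer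
numeral (suc c) = comp succ (numeral c ∷ [])

numeral-eval : ∀ {n} c (xs : Vec ℕ n) → Eval (numeral c) xs c
numeral-eval zero xs = ev-zer
numeral-eval (suc c) xs = ev-comp (numeral-eval c xs ∷ []) ev-succ

lit : ∀ {n} → ℕ → Expr n
lit c = call (computable {F = λ _ → c} (numeral c) (numeral-eval c)) []

uncurry₁ : (ℕ → ℕ) → Vec ℕ 1 → ℕ
uncurry₁ f (x ∷ []) = f x
uncurry₂ : (ℕ → ℕ → ℕ) → Vec ℕ 2 → ℕ
uncurry₂ f (x ∷ y ∷ []) = f x y
uncurry₃ : (ℕ → ℕ → ℕ → ℕ) → Vec ℕ 3 → ℕ
uncurry₃ f (x ∷ y ∷ z ∷ []) = f x y z
uncurry₄ : (ℕ → ℕ → ℕ → ℕ → ℕ) → Vec ℕ 4 → ℕ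
uncurry₄ f (x ∷ y ∷ z ∷ u ∷ []) = f x y z u
uncurry₅ : (ℕ → ℕ → ℕ → ℕ → ℕ → ℕ) → Vec ℕ 5 → ℕ
uncurry₅ f (x ∷ y ∷ z ∷ u ∷ v ∷ []) = f x y z u v
uncurry₆ : (ℕ → ℕ → ℕ → ℕ → ℕ → ℕ → ℕ) → Vec ℕ 6 → ℕ
uncurry₆ f (x ∷ y ∷ z ∷ u ∷ v ∷ w ∷ []) = f x y z u v w

x₀ : ∀ {n} → Expr (suc n)
x₀ = var zero
x₁ : ∀ {n} → Expr (suc (suc n))
x₁ = var (suc zero)
x₂ : ∀ {n} → Expr (suc (suc (suc n)))
x₂ = var (suc (suc zero))
x₃ : ∀ {n} → Expr (suc (suc (suc (suc n))))
x₃ = var (suc (suc (suc zero)))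
x₄ : ∀ {n} → Expr (suc (suc (suc (suc (suc n)))))
x₄ = var (suc (suc (suc (suc zero))))
x₅ : ∀ {n} → Expr (suc (suc (suc (suc (suc (suc n))))))
x₅ = var (suc (suc (suc (suc (suc zero)))))

call₁ : ∀ {n F} → Computable 1 F → Expr n → Expr n
call₁ p a = call p (a ∷ [])
call₂ : ∀ {n F} → Computable 2 F → Expr n → Expr n → Expr n
call₂ p a b = call p (a ∷ b ∷ [])
call₃ : ∀ {n F} → Computable 3 F → Expr n → Expr n → Expr n → Expr n
call₃ p a b c = call p (a ∷ b ∷ c ∷ [])

sucᶜ : Computable 1 (uncurry₁ suc)
sucᶜ = computable succ (λ { (x ∷ []) → ev-succ })

predᶜ : Computable 1 (uncurry₁ pred)
predᶜ = resp-≗ (primRecᶜ {F = λ _ → 0} {G = λ v → lookup v zero}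
                         (computable zer (λ _ → ev-zer)) (computable (proj zero) (λ _ → ev-proj)))
               (λ { (zero ∷ []) → refl ; (suc x ∷ []) → refl })

addᶜ : Computable 2 (uncurry₂ _+_)
addᶜ = resp-≗ (primRecᶜ (fromExpr {F = uncurry₁ (λ y → y)} x₀ λ { (x ∷ []) → refl })
                        (fromExpr {F = uncurry₃ (λ _ r _ → suc r)} (call₁ sucᶜ x₁) λ { (_ ∷ _ ∷ _ ∷ []) → refl }))
              go
  where
  go : ∀ xs → _ ≡ uncurry₂ _+_ xs
  go (zero ∷ y ∷ []) = refl
  go (suc x ∷ y ∷ []) = cong suc (go (x ∷ y ∷ []))

monusᶜ : Computable 2 (uncurry₂ _∸_)
monusᶜ = fromExpr (call₂ flipped x₁ x₀) λ { (x ∷ y ∷ []) → refl }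
  where
  flipped : Computable 2 (uncurry₂ (λ y x → x ∸ y))
  flipped = resp-≗ (primRecᶜ (fromExpr {F = uncurry₁ (λ x → x)} x₀ λ { (x ∷ []) → refl })
                             (fromExpr {F = uncurry₃ (λ _ r _ → pred r)} (call₁ predᶜ x₁) λ { (_ ∷ _ ∷ _ ∷ []) → refl }))
                   go
    where
    go : ∀ xs → _ ≡ uncurry₂ (λ y x → x ∸ y) xs
    go (zero ∷ x ∷ []) = refl
    go (suc y ∷ x ∷ []) = trans (cong pred (go (y ∷ x ∷ []))) (pred[m∸n]≡m∸[1+n] x y)

-- Predicates are computed as numbers, nonzero meaning true.
data Holds : ℕ → Set where
  holds : ∀ {k} → Holds (suc k)

¬Holds-0 : ¬ Holds 0
¬Holds-0 ()

holds? : ∀ n → (n ≡ 0) ⊎ Holds n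
holds? zero = inj₁ refl
holds? (suc n) = inj₂ holds

holds-suc : ∀ {a} → Holds a → Σ ℕ λ v → a ≡ suc v
holds-suc (holds {k}) = k , refl

-- Opaque, so that the large verifier terms below are not unfolded during type checking.
opaque
  ifz : ℕ → ℕ → ℕ → ℕ
  ifz zero a b = a
  ifz (suc _) a b = b

  ifzᶜ : Computable 3 (uncurry₃ ifz)
  ifzᶜ = resp-≗ (primRecᶜ (fromExpr {F = uncurry₂ (λ a b → a)} x₀ λ { (_ ∷ _ ∷ []) → refl })
                          (fromExpr {F = uncurry₄ (λ _ _ a b → b)} x₃ λ { (_ ∷ _ ∷ _ ∷ _ ∷ []) → refl }))
                λ { (zero ∷ a ∷ b ∷ []) → refl ; (suc c ∷ a ∷ b ∷ []) → refl }

  andN : ℕ → ℕ → ℕ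
  andN a b = ifz a 0 b
  orN : ℕ → ℕ → ℕ
  orN a b = ifz a b a
  notN : ℕ → ℕ
  notN a = ifz a 1 0
  eqN : ℕ → ℕ → ℕ
  eqN x y = notN ((x ∸ y) + (y ∸ x))
  ltN : ℕ → ℕ → ℕ
  ltN x y = notN (suc x ∸ y)

  andᶜ : Computable 2 (uncurry₂ andN)
  andᶜ = fromExpr (call₃ ifzᶜ x₀ (lit 0) x₁) λ { (_ ∷ _ ∷ []) → refl }
  orᶜ : Computable 2 (uncurry₂ orN)
  orᶜ = fromExpr (call₃ ifzᶜ x₀ x₁ x₀) λ { (_ ∷ _ ∷ []) → refl }
  notᶜ : Computable 1 (uncurry₁ notN)
  notᶜ = fromExpr (call₃ ifzᶜ x₀ (lit 1) (lit 0)) λ { (_ ∷ []) → refl }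
  eqᶜ : Computable 2 (uncurry₂ eqN)
  eqᶜ = fromExpr (call₁ notᶜ (call₂ addᶜ (call₂ monusᶜ x₀ x₁) (call₂ monusᶜ x₁ x₀))) λ { (_ ∷ _ ∷ []) → refl }
  ltᶜ : Computable 2 (uncurry₂ ltN)
  ltᶜ = fromExpr (call₁ notᶜ (call₂ monusᶜ (call₁ sucᶜ x₀) x₁)) λ { (_ ∷ _ ∷ []) → refl }

  ifz-elim : ∀ c a b → Holds (ifz c a b) → (c ≡ 0 × Holds a) ⊎ (Holds c × Holds b)
  ifz-elim zero a b t = inj₁ (refl , t)
  ifz-elim (suc c) a b t = inj₂ (holds , t)
  ifz-zero : ∀ a b → ifz 0 a b ≡ a
  ifz-zero a b = refl
  ifz-suc : ∀ c a b → ifz (suc c) a b ≡ b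
  ifz-suc c a b = refl

  and-elim : ∀ a b → Holds (andN a b) → Holds a × Holds b
  and-elim zero b ()
  and-elim (suc a) b t = holds , t
  and-intro : ∀ {a b} → Holds a → Holds b → Holds (andN a b)
  and-intro holds t = t

  or-elim : ∀ a b → Holds (orN a b) → Holds a ⊎ Holds b
  or-elim zero b t = inj₂ t
  or-elim (suc a) b t = inj₁ holds
  or-introˡ : ∀ {a} b → Holds a → Holds (orN a b)
  or-introˡ b holds = holds
  or-introʳ : ∀ a {b} → Holds b → Holds (orN a b)
  or-introʳ zero t = t
  or-introʳ (suc a) t = holds

  not-elim : ∀ a → Holds (notN a) → a ≡ 0
  not-elim zero t = refl
  not-elim (suc a) ()
  not-intro : Holds (notN 0)
  not-intro = holds

  eq-elim : ∀ x y → Holds (eqN x y) → x ≡ y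
  eq-elim zero zero t = refl
  eq-elim zero (suc y) ()
  eq-elim (suc x) zero ()
  eq-elim (suc x) (suc y) t = cong suc (eq-elim x y t)
  eq-refl : ∀ x → Holds (eqN x x)
  eq-refl zero = holds
  eq-refl (suc x) = eq-refl x
  eq-intro : ∀ {x y} → x ≡ y → Holds (eqN x y)
  eq-intro {x} refl = eq-refl x
  eqN-≡ : ∀ x → eqN x x ≡ 1
  eqN-≡ zero = refl
  eqN-≡ (suc x) = eqN-≡ x
  eqN-≢ : ∀ x y → x ≢ y → eqN x y ≡ 0
  eqN-≢ zero zero ne = ⊥-elim (ne refl)
  eqN-≢ zero (suc y) ne = refl
  eqN-≢ (suc x) zero ne = refl
  eqN-≢ (suc x) (suc y) ne = eqN-≢ x y (λ e → ne (cong suc e))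

  lt-elim : ∀ x y → Holds (ltN x y) → x < y
  lt-elim zero zero ()
  lt-elim zero (suc y) t = s≤s z≤n
  lt-elim (suc x) zero ()
  lt-elim (suc x) (suc y) t = s≤s (lt-elim x y t)
  lt-intro : ∀ {x y} → x < y → Holds (ltN x y)
  lt-intro {zero} {suc zero} (s≤s z≤n) = holds
  lt-intro {zero} {suc (suc n)} (s≤s z≤n) = holds
  lt-intro {suc x} (s≤s p) = lt-intro p

notN-holds : ∀ {a} → Holds a → notN a ≡ 0
notN-holds {a} t with holds? (notN a)
... | inj₁ e = e
... | inj₂ t' with not-elim a t'
... | refl = ⊥-elim (¬Holds-0 t)

notN-≡0 : ∀ {a} → notN a ≡ 0 → Holds a
notN-≡0 {a} e with holds? a
... | inj₂ t = t
... | inj₁ refl = ⊥-elim (¬Holds-0 (subst Holds e not-intro))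

ifz-zero-intro : ∀ {a} b → Holds a → Holds (ifz 0 a b)
ifz-zero-intro {a} b t = subst Holds (sym (ifz-zero a b)) t

ifz-suc-intro : ∀ c a {b} → Holds b → Holds (ifz (suc c) a b)
ifz-suc-intro c a {b} t = subst Holds (sym (ifz-suc c a b)) t

triᶜ : Computable 1 (uncurry₁ tri)
triᶜ = resp-≗ (primRecᶜ (fromExpr {F = λ _ → 0} (lit 0) λ { [] → refl })
                     (fromExpr {F = uncurry₂ (λ n r → suc n + r)} (call₂ addᶜ (call₁ sucᶜ x₀) x₁) λ { (_ ∷ _ ∷ []) → refl }))
             go
  where
  go : ∀ xs → _ ≡ uncurry₁ tri xs
  go (zero ∷ []) = refl
  go (suc n ∷ []) = cong (suc n +_) (go (n ∷ []))

pairᶜ : Computable 2 (uncurry₂ pair)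
pairᶜ = fromExpr (call₂ addᶜ (call₁ triᶜ (call₂ addᶜ x₀ x₁)) x₁) λ { (_ ∷ _ ∷ []) → refl }

diag : ℕ → ℕ
diag zero = zero
diag (suc n) = ifz (eqN (tri (suc (diag n))) (suc n)) (diag n) (suc (diag n))

diagᶜ : Computable 1 (uncurry₁ diag)
diagᶜ = resp-≗ (primRecᶜ (fromExpr {F = λ _ → 0} (lit 0) λ { [] → refl })
                    (fromExpr {F = uncurry₂ (λ n r → ifz (eqN (tri (suc r)) (suc n)) r (suc r))}
                       (call₃ ifzᶜ (call₂ eqᶜ (call₁ triᶜ (call₁ sucᶜ x₁)) (call₁ sucᶜ x₀)) x₁ (call₁ sucᶜ x₁))
                       λ { (_ ∷ _ ∷ []) → refl }))
            go
  where
  go : ∀ xs → _ ≡ uncurry₁ diag xs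
  go (zero ∷ []) = refl
  go (suc n ∷ []) = cong (λ r → ifz (eqN (tri (suc r)) (suc n)) r (suc r)) (go (n ∷ []))

tri-mono : ∀ {a b} → a ≤ b → tri a ≤ tri b
tri-mono {zero} _ = z≤n
tri-mono {suc a} {suc b} (s≤s p) = s≤s (+-mono-≤ p (tri-mono p))

OnDiagonal : ℕ → ℕ → Set
OnDiagonal w n = tri w ≤ n × n < tri (suc w)

ifz-eqN-≡ : ∀ x y a b → x ≡ y → ifz (eqN x y) a b ≡ b
ifz-eqN-≡ x .x a b refl rewrite eqN-≡ x = ifz-suc 0 a b
ifz-eqN-≢ : ∀ x y a b → ¬ x ≡ y → ifz (eqN x y) a b ≡ a
ifz-eqN-≢ x y a b ne rewrite eqN-≢ x y ne = ifz-zero a b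

diag-onDiagonal : ∀ n → OnDiagonal (diag n) n
diag-onDiagonal zero = z≤n , s≤s z≤n
diag-onDiagonal (suc n) with diag-onDiagonal n | tri (suc (diag n)) ≟ suc n
... | (p , q) | yes e = subst (λ w → OnDiagonal w (suc n)) (sym (ifz-eqN-≡ _ _ (diag n) (suc (diag n)) e))
                           (subst (_≤ suc n) (sym e) ≤-refl ,
                            subst (λ z → suc n < suc (suc (diag n)) + z) (sym e) (s≤s (m≤n+m (suc n) (suc (diag n)))))
... | (p , q) | no ne = subst (λ w → OnDiagonal w (suc n)) (sym (ifz-eqN-≢ _ _ (diag n) (suc (diag n)) ne))
                           (≤-trans p (n≤1+n n) , ≤∧≢⇒< q (λ e → ne (sym e)))

onDiagonal-unique : ∀ {w w' n} → OnDiagonal w n → OnDiagonal w' n → w ≡ w'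
onDiagonal-unique {w} {w'} (p , q) (p' , q') with <-cmp w w'
... | tri≈ _ e _ = e
... | tri< lt _ _ = ⊥-elim (<⇒≱ q (≤-trans (tri-mono lt) p'))
... | tri> _ _ gt = ⊥-elim (<⇒≱ q' (≤-trans (tri-mono gt) p))

diag-unique : ∀ {n} w → OnDiagonal w n → diag n ≡ w
diag-unique w i = onDiagonal-unique (diag-onDiagonal _) i

pair-onDiagonal : ∀ a b → OnDiagonal (a + b) (pair a b)
pair-onDiagonal a b = m≤m+n (tri (a + b)) b ,
  subst (λ z → tri (a + b) + b < z) (+-comm (tri (a + b)) (suc (a + b)))
        (+-monoʳ-< (tri (a + b)) {b} {suc (a + b)} (s≤s (m≤n+m b a)))

opaque
  sndP : ℕ → ℕ
  sndP n = n ∸ tri (diag n)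
  fstP : ℕ → ℕ
  fstP n = diag n ∸ sndP n

  sndᶜ : Computable 1 (uncurry₁ sndP)
  sndᶜ = fromExpr (call₂ monusᶜ x₀ (call₁ triᶜ (call₁ diagᶜ x₀))) λ { (_ ∷ []) → refl }
  fstᶜ : Computable 1 (uncurry₁ fstP)
  fstᶜ = fromExpr (call₂ monusᶜ (call₁ diagᶜ x₀) (call₁ sndᶜ x₀)) λ { (_ ∷ []) → refl }

  snd-pair : ∀ a b → sndP (pair a b) ≡ b
  snd-pair a b rewrite diag-unique (a + b) (pair-onDiagonal a b) = m+n∸m≡n (tri (a + b)) b

  fst-pair : ∀ a b → fstP (pair a b) ≡ a
  fst-pair a b rewrite snd-pair a b | diag-unique (a + b) (pair-onDiagonal a b) = m+n∸n≡m a b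

  pair-unpair : ∀ n → pair (fstP n) (sndP n) ≡ n
  pair-unpair n with diag-onDiagonal n
  ... | (p , q) = trans (cong (λ z → tri z + sndP n) e) (m+[n∸m]≡n p)
    where
    b≤s : sndP n ≤ diag n
    b≤s = Data.Nat.Properties.≤-pred (subst (sndP n <_) (m+n∸n≡m (suc (diag n)) (tri (diag n)))
            (∸-monoˡ-< q p))
    e : fstP n + sndP n ≡ diag n
    e = m∸n+n≡m b≤s

pair-injective : ∀ {a b c d} → pair a b ≡ pair c d → a ≡ c × b ≡ d
pair-injective {a} {b} {c} {d} e =
  trans (sym (fst-pair a b)) (trans (cong fstP e) (fst-pair c d)) ,
  trans (sym (snd-pair a b)) (trans (cong sndP e) (snd-pair c d))

pair-≥r : ∀ a b → b ≤ pair a b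
pair-≥r a b = m≤n+m b (tri (a + b))

sndP-≤ : ∀ n → sndP n ≤ n
sndP-≤ n = subst (sndP n ≤_) (pair-unpair n) (pair-≥r (fstP n) (sndP n))

⟪tabulate-var⟫ : ∀ {m n} (f : Fin n → Fin m) ys → ⟪ tabulate (λ i → var (f i)) ⟫* ys ≡ tabulate (λ i → lookup ys (f i))
⟪tabulate-var⟫ {n = zero} f ys = refl
⟪tabulate-var⟫ {n = suc n} f ys = cong (lookup ys (f zero) ∷_) (⟪tabulate-var⟫ (λ i → f (suc i)) ys)

skip₂ : ∀ {n} → Vec (Expr (suc (suc n))) n
skip₂ = tabulate (λ i → var (suc (suc i)))

⟪skip₂⟫ : ∀ {n} a b (xs : Vec ℕ n) → ⟪ skip₂ ⟫* (a ∷ b ∷ xs) ≡ xs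
⟪skip₂⟫ a b xs = trans (⟪tabulate-var⟫ (λ i → suc (suc i)) (a ∷ b ∷ xs)) (tabulate∘lookup xs)

iter : (ℕ → ℕ) → ℕ → ℕ → ℕ
iter f zero x = x
iter f (suc p) x = f (iter f p x)

iterᶜ : ∀ {f} → Computable 1 (uncurry₁ f) → Computable 2 (uncurry₂ (iter f))
iterᶜ {f} pf = resp-≗ (primRecᶜ (fromExpr {F = uncurry₁ (λ x → x)} x₀ λ { (_ ∷ []) → refl })
                           (fromExpr {F = uncurry₃ (λ _ r _ → f r)} (call₁ pf x₁) λ { (_ ∷ _ ∷ _ ∷ []) → refl }))
                   go
  where
  go : ∀ xs → _ ≡ uncurry₂ (iter f) xs
  go (zero ∷ x ∷ []) = refl
  go (suc p ∷ x ∷ []) = cong f (go (p ∷ x ∷ []))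

foldBelow : (ℕ → ℕ → ℕ) → ℕ → ℕ → (ℕ → ℕ) → ℕ
foldBelow _⊕_ e zero f = e
foldBelow _⊕_ e (suc k) f = foldBelow _⊕_ e k f ⊕ f k

foldBelowᵛ : ∀ {n} → (ℕ → ℕ → ℕ) → ℕ → (Vec ℕ (suc n) → ℕ) → Vec ℕ (suc n) → ℕ
foldBelowᵛ _⊕_ e P (k ∷ xs) = foldBelow _⊕_ e k (λ j → P (j ∷ xs))

foldBelowᶜ : ∀ {n op P} e → Computable 2 (uncurry₂ op) → Computable (suc n) P → Computable (suc n) (foldBelowᵛ op e P)
foldBelowᶜ {n} {op} {P} e opᶜ Pᶜ =
  resp-≗ (primRecᶜ (fromExpr {F = λ _ → e} (lit e) (λ _ → refl)) (fromExpr {F = G} (call₂ opᶜ x₁ (call Pᶜ (x₀ ∷ skip₂))) ⟪step⟫))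
         go
  where
  G : Vec ℕ (suc (suc n)) → ℕ
  G (j ∷ r ∷ xs) = op r (P (j ∷ xs))
  ⟪step⟫ : ∀ xs → _ ≡ G xs
  ⟪step⟫ (j ∷ r ∷ xs) = cong (λ z → op r (P (j ∷ z))) (⟪skip₂⟫ j r xs)
  go : ∀ xs → primRec (λ _ → e) G xs ≡ foldBelowᵛ op e P xs
  go (zero ∷ xs) = refl
  go (suc k ∷ xs) = cong (λ z → op z (P (k ∷ xs))) (go (k ∷ xs))

allBelow : ℕ → (ℕ → ℕ) → ℕ
allBelow = foldBelow andN 1

anyBelow : ℕ → (ℕ → ℕ) → ℕ
anyBelow = foldBelow orN 0

cons : ℕ → ℕ → ℕ
cons h t = suc (pair h t)
hd : ℕ → ℕ
hd l = fstP (pred l)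
tl : ℕ → ℕ
tl l = sndP (pred l)

consᶜ : Computable 2 (uncurry₂ cons)
consᶜ = fromExpr (call₁ sucᶜ (call₂ pairᶜ x₀ x₁)) λ { (_ ∷ _ ∷ []) → refl }
hdᶜ : Computable 1 (uncurry₁ hd)
hdᶜ = fromExpr (call₁ fstᶜ (call₁ predᶜ x₀)) λ { (_ ∷ []) → refl }
tlᶜ : Computable 1 (uncurry₁ tl)
tlᶜ = fromExpr (call₁ sndᶜ (call₁ predᶜ x₀)) λ { (_ ∷ []) → refl }

tls : ℕ → ℕ → ℕ
tls = iter tl
tlsᶜ : Computable 2 (uncurry₂ tls)
tlsᶜ = iterᶜ tlᶜ

nth : ℕ → ℕ → ℕ
nth l j = hd (tls j l)
nthᶜ : Computable 2 (uncurry₂ nth)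
nthᶜ = fromExpr (call₁ hdᶜ (call₂ tlsᶜ x₁ x₀)) λ { (_ ∷ _ ∷ []) → refl }

listCode : List ℕ → ℕ
listCode [] = 0
listCode (h ∷ L) = cons h (listCode L)

hd-cons : ∀ h t → hd (cons h t) ≡ h
hd-cons = fst-pair

tl-cons : ∀ h t → tl (cons h t) ≡ t
tl-cons = snd-pair

listCode-injective : ∀ {L L'} → listCode L ≡ listCode L' → L ≡ L'
listCode-injective {[]} {[]} e = refl
listCode-injective {[]} {_ ∷ _} ()
listCode-injective {_ ∷ _} {[]} ()
listCode-injective {x ∷ L} {y ∷ L'} e with pair-injective (suc-injective e)
... | e₁ , e₂ = cong₂ _∷_ e₁ (listCode-injective e₂)

listCode-surjective : ∀ n → Σ (List ℕ) λ L → listCode L ≡ n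
listCode-surjective n = go n n ≤-refl
  where
  go : ∀ fuel n → n ≤ fuel → Σ (List ℕ) λ L → listCode L ≡ n
  go fuel zero _ = [] , refl
  go (suc fuel) (suc n) (s≤s n≤fuel) with go fuel (sndP n) (≤-trans (sndP-≤ n) n≤fuel)
  ... | L , e = fstP n ∷ L , cong suc (trans (cong (pair (fstP n)) e) (pair-unpair n))

length≤listCode : ∀ L → length L ≤ listCode L
length≤listCode [] = z≤n
length≤listCode (h ∷ L) = s≤s (≤-trans (length≤listCode L) (pair-≥r h (listCode L)))

tail′ : List ℕ → List ℕ
tail′ [] = []
tail′ (_ ∷ L) = L

drop-suc : ∀ p (L : List ℕ) → drop (suc p) L ≡ tail′ (drop p L)
drop-suc zero [] = refl
drop-suc zero (x ∷ L) = refl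
drop-suc (suc p) [] = refl
drop-suc (suc p) (x ∷ L) = drop-suc p L

tl-listCode : ∀ L → tl (listCode L) ≡ listCode (tail′ L)
tl-listCode [] = snd-pair 0 0
tl-listCode (h ∷ L) = tl-cons h (listCode L)

tls-listCode : ∀ p L → tls p (listCode L) ≡ listCode (drop p L)
tls-listCode zero L = refl
tls-listCode (suc p) L = begin
  tl (tls p (listCode L))        ≡⟨ cong tl (tls-listCode p L) ⟩
  tl (listCode (drop p L))       ≡⟨ tl-listCode (drop p L) ⟩
  listCode (tail′ (drop p L))    ≡⟨ cong listCode (drop-suc p L) ⟨
  listCode (drop (suc p) L)      ∎
  where open ≡-Reasoning

-- Total indexing: out-of-range positions read 0, as hd does on the empty code.
at : List ℕ → ℕ → ℕ
at [] j = 0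
at (x ∷ L) zero = x
at (x ∷ L) (suc j) = at L j

hd-listCode-drop : ∀ L j → hd (listCode (drop j L)) ≡ at L j
hd-listCode-drop [] j rewrite drop-[] {A = ℕ} j = fst-pair 0 0
hd-listCode-drop (x ∷ L) zero = hd-cons x (listCode L)
hd-listCode-drop (x ∷ L) (suc j) = hd-listCode-drop L j

nth-listCode : ∀ L j → nth (listCode L) j ≡ at L j
nth-listCode L j = trans (cong hd (tls-listCode j L)) (hd-listCode-drop L j)

drop-∷⇒< : ∀ p (L : List ℕ) {x R} → drop p L ≡ x ∷ R → p < length L
drop-∷⇒< p L e = m∸n≢0⇒n<m λ len≡0 → 1+n≢0 (trans (cong length (sym e)) (trans (length-drop p L) len≡0))

<⇒drop-∷ : ∀ p (L : List ℕ) → p < length L → Σ ℕ λ x → Σ (List ℕ) λ R → drop p L ≡ x ∷ R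
<⇒drop-∷ p L lt with drop p L | length-drop p L
... | [] | e = ⊥-elim (m>n⇒m∸n≢0 lt (sym e))
... | x ∷ R | _ = x , R , refl

drop-∷⇒∈ : ∀ p (L : List ℕ) {x R} → drop p L ≡ x ∷ R → x ∈ L
drop-∷⇒∈ zero (y ∷ L) refl = here refl
drop-∷⇒∈ (suc p) (y ∷ L) e = there (drop-∷⇒∈ p L e)

∈⇒drop-∷ : ∀ {x} (L : List ℕ) → x ∈ L → Σ ℕ λ p → Σ (List ℕ) λ R → drop p L ≡ x ∷ R
∈⇒drop-∷ (x ∷ R) (here refl) = 0 , R , refl
∈⇒drop-∷ (y ∷ L) (there x∈L) with ∈⇒drop-∷ L x∈L
... | p , R , e = suc p , R , e

allBelow-elim : ∀ k f → Holds (allBelow k f) → ∀ j → j < k → Holds (f j)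
allBelow-elim (suc k) f t j (s≤s le) with and-elim (allBelow k f) (f k) t | m≤n⇒m<n∨m≡n le
... | t₁ , t₂ | inj₁ lt = allBelow-elim k f t₁ j lt
... | t₁ , t₂ | inj₂ refl = t₂

allBelow-intro : ∀ k f → (∀ j → j < k → Holds (f j)) → Holds (allBelow k f)
allBelow-intro zero f h = holds
allBelow-intro (suc k) f h = and-intro (allBelow-intro k f (λ j lt → h j (m≤n⇒m≤1+n lt))) (h k ≤-refl)

anyBelow-elim : ∀ k f → Holds (anyBelow k f) → Σ ℕ λ j → j < k × Holds (f j)
anyBelow-elim (suc k) f t with or-elim (anyBelow k f) (f k) t
... | inj₁ t′ = let j , lt , tj = anyBelow-elim k f t′ in j , m≤n⇒m≤1+n lt , tj
... | inj₂ t′ = k , ≤-refl , t′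

anyBelow-intro : ∀ k f j → j < k → Holds (f j) → Holds (anyBelow k f)
anyBelow-intro (suc k) f j (s≤s le) t with m≤n⇒m<n∨m≡n le
... | inj₁ lt = or-introˡ (f k) (anyBelow-intro k f j lt t)
... | inj₂ refl = or-introʳ (anyBelow k f) t

-- Quantification over the suffixes of a coded list; position p ranges below the code,
-- which bounds the length.
allSuffixes : (ℕ → ℕ) → ℕ → ℕ
allSuffixes G l = allBelow l (λ p → G (tls p l))

anySuffix : (ℕ → ℕ → ℕ) → ℕ → ℕ → ℕ
anySuffix G a l = anyBelow l (λ p → G a (tls p l))

allSuffixesᶜ : ∀ {G} → Computable 1 (uncurry₁ G) → Computable 1 (uncurry₁ (allSuffixes G))
allSuffixesᶜ {G} g = fromExpr (call (foldBelowᶜ 1 andᶜ inner) (x₀ ∷ x₀ ∷ [])) λ { (_ ∷ []) → refl }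
  where
  inner : Computable 2 (uncurry₂ (λ p l → G (tls p l)))
  inner = fromExpr (call₁ g (call₂ tlsᶜ x₀ x₁)) λ { (_ ∷ _ ∷ []) → refl }

anySuffixᶜ : ∀ {G} → Computable 2 (uncurry₂ G) → Computable 2 (uncurry₂ (anySuffix G))
anySuffixᶜ {G} g = fromExpr (call (foldBelowᶜ 0 orᶜ inner) (x₁ ∷ x₀ ∷ x₁ ∷ [])) λ { (_ ∷ _ ∷ []) → refl }
  where
  inner : Computable 3 (uncurry₃ (λ p a l → G a (tls p l)))
  inner = fromExpr (call₂ g x₁ (call₂ tlsᶜ x₀ x₂)) λ { (_ ∷ _ ∷ _ ∷ []) → refl }

allSuffixes-elim : ∀ G L → Holds (allSuffixes G (listCode L)) → ∀ p → p < length L → Holds (G (listCode (drop p L)))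
allSuffixes-elim G L t p lt =
  subst (λ m → Holds (G m)) (tls-listCode p L) (allBelow-elim (listCode L) _ t p (≤-trans lt (length≤listCode L)))

allSuffixes-intro : ∀ G L → (∀ p → Holds (G (listCode (drop p L)))) → Holds (allSuffixes G (listCode L))
allSuffixes-intro G L h = allBelow-intro (listCode L) _ λ p _ → subst (λ m → Holds (G m)) (sym (tls-listCode p L)) (h p)

anySuffix-elim : ∀ G a L → Holds (anySuffix G a (listCode L)) → Σ ℕ λ p → Holds (G a (listCode (drop p L)))
anySuffix-elim G a L t =
  let p , _ , tp = anyBelow-elim (listCode L) _ t in p , subst (λ m → Holds (G a m)) (tls-listCode p L) tp

anySuffix-intro : ∀ G a L p → p < length L → Holds (G a (listCode (drop p L))) → Holds (anySuffix G a (listCode L))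
anySuffix-intro G a L p lt t =
  anyBelow-intro _ _ p (≤-trans lt (length≤listCode L)) (subst (λ m → Holds (G a m)) (sym (tls-listCode p L)) t)

memStep : (ℕ → ℕ) → ℕ → ℕ → ℕ
memStep f key m = andN m (eqN (f (hd m)) key)

memWith : (ℕ → ℕ) → ℕ → ℕ → ℕ
memWith f = anySuffix (memStep f)

memWithᶜ : ∀ {f} → Computable 1 (uncurry₁ f) → Computable 2 (uncurry₂ (memWith f))
memWithᶜ fᶜ = anySuffixᶜ (fromExpr (call₂ andᶜ x₁ (call₂ eqᶜ (call₁ fᶜ (call₁ hdᶜ x₁)) x₀)) λ { (_ ∷ _ ∷ []) → refl })

memWith-elim : ∀ f key R → Holds (memWith f key (listCode R)) → Σ ℕ λ J → J ∈ R × f J ≡ key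
memWith-elim f key R t with anySuffix-elim (memStep f) key R t
... | p , tp with drop p R in eq
...   | [] = ⊥-elim (¬Holds-0 (proj₁ (and-elim _ _ tp)))
...   | J ∷ M = J , drop-∷⇒∈ p R eq , trans (cong f (sym (hd-cons J (listCode M)))) (eq-elim _ _ (proj₂ (and-elim _ _ tp)))

memWith-intro : ∀ f key R J → J ∈ R → f J ≡ key → Holds (memWith f key (listCode R))
memWith-intro f key R J J∈R e with ∈⇒drop-∷ R J∈R
... | p , M , d = anySuffix-intro (memStep f) key R p (drop-∷⇒< p R d)
      (subst (λ L → Holds (memStep f key (listCode L))) (sym d)
             (and-intro holds (eq-intro (trans (cong f (hd-cons J (listCode M))) e))))

memKey : ℕ → ℕ → ℕ
memKey = memWith fstP
memKeyᶜ : Computable 2 (uncurry₂ memKey)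
memKeyᶜ = memWithᶜ fstᶜ

HasKey : ℕ → List ℕ → Set
HasKey key R = Σ ℕ λ J → J ∈ R × fstP J ≡ key

memKey-elim : ∀ key R → Holds (memKey key (listCode R)) → HasKey key R
memKey-elim = memWith-elim fstP

memKey-intro : ∀ key R → HasKey key R → Holds (memKey key (listCode R))
memKey-intro key R (J , J∈R , e) = memWith-intro fstP key R J J∈R e

mem : ℕ → ℕ → ℕ
mem = memWith (λ x → x)
memᶜ : Computable 2 (uncurry₂ mem)
memᶜ = memWithᶜ (fromExpr x₀ λ { (_ ∷ []) → refl })

mem-elim : ∀ key R → Holds (mem key (listCode R)) → key ∈ R
mem-elim key R t = let J , J∈R , e = memWith-elim (λ x → x) key R t in subst (_∈ R) e J∈R

mem-intro : ∀ key R → key ∈ R → Holds (mem key (listCode R))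
mem-intro key R key∈R = memWith-intro (λ x → x) key R key key∈R refl

hasLength : ℕ → ℕ → ℕ
hasLength l n = andN (eqN (tls n l) 0) (ifz n 1 (tls (pred n) l))
hasLengthᶜ : Computable 2 (uncurry₂ hasLength)
hasLengthᶜ = fromExpr (call₂ andᶜ (call₂ eqᶜ (call₂ tlsᶜ x₁ x₀) (lit 0)) (call₃ ifzᶜ x₁ (lit 1) (call₂ tlsᶜ (call₁ predᶜ x₁) x₀)))
                      λ { (_ ∷ _ ∷ []) → refl }

hasLength-elim : ∀ L n → Holds (hasLength (listCode L) n) → length L ≡ n
hasLength-elim L n t with and-elim _ _ t
... | t₁ , t₂ = ≤-antisym length≤n (n≤length n t₂)
  where
  length≤n : length L ≤ n
  length≤n = m∸n≡0⇒m≤n (trans (sym (length-drop n L))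
                (cong length (listCode-injective {L' = []} (trans (sym (tls-listCode n L)) (eq-elim _ _ t₁)))))
  n≤length : ∀ n → Holds (ifz n 1 (tls (pred n) (listCode L))) → n ≤ length L
  n≤length zero _ = z≤n
  n≤length (suc m) t with ifz-elim (suc m) 1 (tls m (listCode L)) t
  ... | inj₂ (_ , t′) with drop m L in eq
  ...   | x ∷ R = drop-∷⇒< m L eq
  ...   | [] = ⊥-elim (¬Holds-0 (subst Holds (trans (tls-listCode m L) (cong listCode eq)) t′))

hasLength-intro : ∀ L → Holds (hasLength (listCode L) (length L))
hasLength-intro L =
  and-intro (eq-intro (trans (tls-listCode (length L) L) (cong listCode (drop-all (length L) L ≤-refl))))
            (positive (length L) ≤-refl)
  where
  positive : ∀ n → n ≤ length L → Holds (ifz n 1 (tls (pred n) (listCode L)))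
  positive zero _ = ifz-zero-intro _ holds
  positive (suc m) lt with <⇒drop-∷ m L lt
  ... | x , R , e = ifz-suc-intro m 1 (subst Holds (sym (trans (tls-listCode m L) (cong listCode e))) holds)

-- A certificate is a coded list of entries  pair key w,  each justified by the entries after it.
-- evalKey c xs y  claims that the term coded c maps the list coded xs to y; the witness w holds what the
-- rule needs (the intermediate values of a composition, the previous value of a recursion step, the
-- values below a μ-root).  wfKey d a  claims that d codes a term of arity a.  The step checks below
-- receive the part of a code after its constructor tag as  body.

byTag : ℕ → ℕ → ℕ → ℕ → ℕ → ℕ → ℕ → ℕ
byTag t a₀ a₁ a₂ a₃ a₄ a₅ =
  orN (andN (eqN t 0) a₀) (orN (andN (eqN t 1) a₁) (orN (andN (eqN t 2) a₂)
  (orN (andN (eqN t 3) a₃) (orN (andN (eqN t 4) a₄) (andN (eqN t 5) a₅)))))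

byTagᴱ : ∀ {n} → Expr n → Expr n → Expr n → Expr n → Expr n → Expr n → Expr n → Expr n
byTagᴱ t a₀ a₁ a₂ a₃ a₄ a₅ =
  call₂ orᶜ (when 0 a₀) (call₂ orᶜ (when 1 a₁) (call₂ orᶜ (when 2 a₂)
  (call₂ orᶜ (when 3 a₃) (call₂ orᶜ (when 4 a₄) (when 5 a₅)))))
  where
  when : ℕ → Expr _ → Expr _
  when i a = call₂ andᶜ (call₂ eqᶜ t (lit i)) a

byTag-elim : ∀ {P : Set} t {a₀ a₁ a₂ a₃ a₄ a₅} →
  (t ≡ 0 → Holds a₀ → P) → (t ≡ 1 → Holds a₁ → P) → (t ≡ 2 → Holds a₂ → P) →
  (t ≡ 3 → Holds a₃ → P) → (t ≡ 4 → Holds a₄ → P) → (t ≡ 5 → Holds a₅ → P) →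
  Holds (byTag t a₀ a₁ a₂ a₃ a₄ a₅) → P
byTag-elim t k₀ k₁ k₂ k₃ k₄ k₅ h₀ with or-elim _ _ h₀
... | inj₁ h = let e , h′ = and-elim _ _ h in k₀ (eq-elim _ _ e) h′
... | inj₂ h₁ with or-elim _ _ h₁
... | inj₁ h = let e , h′ = and-elim _ _ h in k₁ (eq-elim _ _ e) h′
... | inj₂ h₂ with or-elim _ _ h₂
... | inj₁ h = let e , h′ = and-elim _ _ h in k₂ (eq-elim _ _ e) h′
... | inj₂ h₃ with or-elim _ _ h₃
... | inj₁ h = let e , h′ = and-elim _ _ h in k₃ (eq-elim _ _ e) h′
... | inj₂ h₄ with or-elim _ _ h₄
... | inj₁ h = let e , h′ = and-elim _ _ h in k₄ (eq-elim _ _ e) h′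
... | inj₂ h = let e , h′ = and-elim _ _ h in k₅ (eq-elim _ _ e) h′

module _ {a₀ a₁ a₂ a₃ a₄ a₅ : ℕ} where

  byTag-intro₀ : Holds a₀ → Holds (byTag 0 a₀ a₁ a₂ a₃ a₄ a₅)
  byTag-intro₀ h = or-introˡ _ (and-intro (eq-refl 0) h)

  byTag-intro₁ : Holds a₁ → Holds (byTag 1 a₀ a₁ a₂ a₃ a₄ a₅)
  byTag-intro₁ h = or-introʳ _ (or-introˡ _ (and-intro (eq-refl 1) h))

  byTag-intro₂ : Holds a₂ → Holds (byTag 2 a₀ a₁ a₂ a₃ a₄ a₅)
  byTag-intro₂ h = or-introʳ _ (or-introʳ _ (or-introˡ _ (and-intro (eq-refl 2) h)))

  byTag-intro₃ : Holds a₃ → Holds (byTag 3 a₀ a₁ a₂ a₃ a₄ a₅)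
  byTag-intro₃ h = or-introʳ _ (or-introʳ _ (or-introʳ _ (or-introˡ _ (and-intro (eq-refl 3) h))))

  byTag-intro₄ : Holds a₄ → Holds (byTag 4 a₀ a₁ a₂ a₃ a₄ a₅)
  byTag-intro₄ h = or-introʳ _ (or-introʳ _ (or-introʳ _ (or-introʳ _ (or-introˡ _ (and-intro (eq-refl 4) h)))))

  byTag-intro₅ : Holds a₅ → Holds (byTag 5 a₀ a₁ a₂ a₃ a₄ a₅)
  byTag-intro₅ h = or-introʳ _ (or-introʳ _ (or-introʳ _ (or-introʳ _ (or-introʳ _ (and-intro (eq-refl 5) h)))))

evalKey : ℕ → ℕ → ℕ → ℕ
evalKey c xs y = pair 0 (pair c (pair xs y))
evalKeyᶜ : Computable 3 (uncurry₃ evalKey)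
evalKeyᶜ = fromExpr (call₂ pairᶜ (lit 0) (call₂ pairᶜ x₀ (call₂ pairᶜ x₁ x₂))) λ { (_ ∷ _ ∷ _ ∷ []) → refl }

wfKey : ℕ → ℕ → ℕ
wfKey d a = pair 1 (pair d (pair a 0))
wfKeyᶜ : Computable 2 (uncurry₂ wfKey)
wfKeyᶜ = fromExpr (call₂ pairᶜ (lit 1) (call₂ pairᶜ x₀ (call₂ pairᶜ x₁ (lit 0)))) λ { (_ ∷ _ ∷ []) → refl }

zerOk : ℕ → ℕ → ℕ → ℕ
zerOk body xs y = andN (hasLength xs body) (eqN y 0)
zerOkᶜ : Computable 3 (uncurry₃ zerOk)
zerOkᶜ = fromExpr (call₂ andᶜ (call₂ hasLengthᶜ x₁ x₀) (call₂ eqᶜ x₂ (lit 0))) λ { (_ ∷ _ ∷ _ ∷ []) → refl }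

sucOk : ℕ → ℕ → ℕ → ℕ
sucOk body xs y = andN (eqN body 0) (andN (hasLength xs 1) (eqN y (suc (hd xs))))
sucOkᶜ : Computable 3 (uncurry₃ sucOk)
sucOkᶜ = fromExpr (call₂ andᶜ (call₂ eqᶜ x₀ (lit 0)) (call₂ andᶜ (call₂ hasLengthᶜ x₁ (lit 1)) (call₂ eqᶜ x₂ (call₁ sucᶜ (call₁ hdᶜ x₁)))))
                 λ { (_ ∷ _ ∷ _ ∷ []) → refl }

projOk : ℕ → ℕ → ℕ → ℕ
projOk body xs y = andN (hasLength xs (fstP body)) (andN (ltN (sndP body) (fstP body)) (eqN y (nth xs (sndP body))))
projOkᶜ : Computable 3 (uncurry₃ projOk)
projOkᶜ = fromExpr (call₂ andᶜ (call₂ hasLengthᶜ x₁ (call₁ fstᶜ x₀))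
                     (call₂ andᶜ (call₂ ltᶜ (call₁ sndᶜ x₀) (call₁ fstᶜ x₀)) (call₂ eqᶜ x₂ (call₂ nthᶜ x₁ (call₁ sndᶜ x₀)))))
                  λ { (_ ∷ _ ∷ _ ∷ []) → refl }

compInner : ℕ → ℕ → ℕ → ℕ → ℕ → ℕ
compInner j cgs xs w r = memKey (evalKey (nth cgs j) xs (nth w j)) r
compInnerᶜ : Computable 5 (uncurry₅ compInner)
compInnerᶜ = fromExpr (call₂ memKeyᶜ (call₃ evalKeyᶜ (call₂ nthᶜ x₁ x₀) x₂ (call₂ nthᶜ x₃ x₀)) x₄) λ { (_ ∷ _ ∷ _ ∷ _ ∷ _ ∷ []) → refl }

compOk : ℕ → ℕ → ℕ → ℕ → ℕ → ℕ
compOk body xs y w r =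
  andN (hasLength xs (sndP (fstP body)))
  (andN (hasLength w (fstP (fstP body)))
  (andN (hasLength (sndP (sndP body)) (fstP (fstP body)))
  (andN (memKey (evalKey (fstP (sndP body)) w y) r)
        (allBelow (fstP (fstP body)) (λ j → compInner j (sndP (sndP body)) xs w r)))))
compOkᶜ : Computable 5 (uncurry₅ compOk)
compOkᶜ = fromExpr
  (call₂ andᶜ (call₂ hasLengthᶜ x₁ (call₁ sndᶜ (call₁ fstᶜ x₀)))
  (call₂ andᶜ (call₂ hasLengthᶜ x₃ (call₁ fstᶜ (call₁ fstᶜ x₀)))
  (call₂ andᶜ (call₂ hasLengthᶜ (call₁ sndᶜ (call₁ sndᶜ x₀)) (call₁ fstᶜ (call₁ fstᶜ x₀)))
  (call₂ andᶜ (call₂ memKeyᶜ (call₃ evalKeyᶜ (call₁ fstᶜ (call₁ sndᶜ x₀)) x₃ x₂) x₄)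
            (call (foldBelowᶜ 1 andᶜ compInnerᶜ) (call₁ fstᶜ (call₁ fstᶜ x₀) ∷ call₁ sndᶜ (call₁ sndᶜ x₀) ∷ x₁ ∷ x₃ ∷ x₄ ∷ []))))))
  λ { (_ ∷ _ ∷ _ ∷ _ ∷ _ ∷ []) → refl }

precOk : ℕ → ℕ → ℕ → ℕ → ℕ → ℕ → ℕ
precOk c body xs y w r =
  andN (hasLength xs (suc (fstP body)))
       (ifz (hd xs) (andN (memKey (evalKey (fstP (sndP body)) (tl xs) y) r) (memKey (wfKey (sndP (sndP body)) (suc (suc (fstP body)))) r))
            (andN (memKey (evalKey c (cons (pred (hd xs)) (tl xs)) w) r)
                  (memKey (evalKey (sndP (sndP body)) (cons (pred (hd xs)) (cons w (tl xs))) y) r)))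
precOkᶜ : Computable 6 (uncurry₆ precOk)
precOkᶜ = fromExpr
  (call₂ andᶜ (call₂ hasLengthᶜ x₂ (call₁ sucᶜ (call₁ fstᶜ x₁)))
    (call₃ ifzᶜ (call₁ hdᶜ x₂) (call₂ andᶜ (call₂ memKeyᶜ (call₃ evalKeyᶜ (call₁ fstᶜ (call₁ sndᶜ x₁)) (call₁ tlᶜ x₂) x₃) x₅)
                                     (call₂ memKeyᶜ (call₂ wfKeyᶜ (call₁ sndᶜ (call₁ sndᶜ x₁)) (call₁ sucᶜ (call₁ sucᶜ (call₁ fstᶜ x₁)))) x₅))
       (call₂ andᶜ (call₂ memKeyᶜ (call₃ evalKeyᶜ x₀ (call₂ consᶜ (call₁ predᶜ (call₁ hdᶜ x₂)) (call₁ tlᶜ x₂)) x₄) x₅)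
                 (call₂ memKeyᶜ (call₃ evalKeyᶜ (call₁ sndᶜ (call₁ sndᶜ x₁)) (call₂ consᶜ (call₁ predᶜ (call₁ hdᶜ x₂)) (call₂ consᶜ x₄ (call₁ tlᶜ x₂))) x₃) x₅))))
  λ { (_ ∷ _ ∷ _ ∷ _ ∷ _ ∷ _ ∷ []) → refl }

muInner : ℕ → ℕ → ℕ → ℕ → ℕ → ℕ
muInner z cf xs w r = memKey (evalKey cf (cons z xs) (suc (nth w z))) r
muInnerᶜ : Computable 5 (uncurry₅ muInner)
muInnerᶜ = fromExpr (call₂ memKeyᶜ (call₃ evalKeyᶜ x₁ (call₂ consᶜ x₀ x₂) (call₁ sucᶜ (call₂ nthᶜ x₃ x₀))) x₄) λ { (_ ∷ _ ∷ _ ∷ _ ∷ _ ∷ []) → refl }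

muOk : ℕ → ℕ → ℕ → ℕ → ℕ → ℕ
muOk body xs y w r =
  andN (hasLength xs (fstP body))
  (andN (memKey (evalKey (sndP body) (cons y xs) 0) r)
        (allBelow y (λ z → muInner z (sndP body) xs w r)))
muOkᶜ : Computable 5 (uncurry₅ muOk)
muOkᶜ = fromExpr
  (call₂ andᶜ (call₂ hasLengthᶜ x₁ (call₁ fstᶜ x₀))
  (call₂ andᶜ (call₂ memKeyᶜ (call₃ evalKeyᶜ (call₁ sndᶜ x₀) (call₂ consᶜ x₂ x₁) (lit 0)) x₄)
            (call (foldBelowᶜ 1 andᶜ muInnerᶜ) (x₂ ∷ call₁ sndᶜ x₀ ∷ x₁ ∷ x₃ ∷ x₄ ∷ []))))
  λ { (_ ∷ _ ∷ _ ∷ _ ∷ _ ∷ []) → refl }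

evalOk : ℕ → ℕ → ℕ → ℕ → ℕ → ℕ
evalOk c xs y w r = byTag (fstP c) (zerOk b xs y) (sucOk b xs y) (projOk b xs y)
                                   (compOk b xs y w r) (precOk c b xs y w r) (muOk b xs y w r)
  where b = sndP c
evalOkᶜ : Computable 5 (uncurry₅ evalOk)
evalOkᶜ = fromExpr
  (byTagᴱ (call₁ fstᶜ x₀) (call₃ zerOkᶜ B x₁ x₂) (call₃ sucOkᶜ B x₁ x₂) (call₃ projOkᶜ B x₁ x₂)
          (call compOkᶜ (B ∷ x₁ ∷ x₂ ∷ x₃ ∷ x₄ ∷ [])) (call precOkᶜ (x₀ ∷ B ∷ x₁ ∷ x₂ ∷ x₃ ∷ x₄ ∷ []))
          (call muOkᶜ (B ∷ x₁ ∷ x₂ ∷ x₃ ∷ x₄ ∷ [])))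
  λ { (_ ∷ _ ∷ _ ∷ _ ∷ _ ∷ []) → refl }
  where
  B : Expr 5
  B = call₁ sndᶜ x₀

wcInner : ℕ → ℕ → ℕ → ℕ → ℕ
wcInner j cgs a r = memKey (wfKey (nth cgs j) a) r
wcInnerᶜ : Computable 4 (uncurry₄ wcInner)
wcInnerᶜ = fromExpr (call₂ memKeyᶜ (call₂ wfKeyᶜ (call₂ nthᶜ x₁ x₀) x₂) x₃) λ { (_ ∷ _ ∷ _ ∷ _ ∷ []) → refl }

wfComp : ℕ → ℕ → ℕ → ℕ
wfComp db a r = andN (eqN (sndP (fstP db)) a)
                (andN (memKey (wfKey (fstP (sndP db)) (fstP (fstP db))) r)
                (andN (hasLength (sndP (sndP db)) (fstP (fstP db)))
                      (allBelow (fstP (fstP db)) (λ j → wcInner j (sndP (sndP db)) a r))))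
wfCompᶜ : Computable 3 (uncurry₃ wfComp)
wfCompᶜ = fromExpr
  (call₂ andᶜ (call₂ eqᶜ (call₁ sndᶜ (call₁ fstᶜ x₀)) x₁)
  (call₂ andᶜ (call₂ memKeyᶜ (call₂ wfKeyᶜ (call₁ fstᶜ (call₁ sndᶜ x₀)) (call₁ fstᶜ (call₁ fstᶜ x₀))) x₂)
  (call₂ andᶜ (call₂ hasLengthᶜ (call₁ sndᶜ (call₁ sndᶜ x₀)) (call₁ fstᶜ (call₁ fstᶜ x₀)))
            (call (foldBelowᶜ 1 andᶜ wcInnerᶜ) (call₁ fstᶜ (call₁ fstᶜ x₀) ∷ call₁ sndᶜ (call₁ sndᶜ x₀) ∷ x₁ ∷ x₂ ∷ [])))))
  λ { (_ ∷ _ ∷ _ ∷ []) → refl }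

wfPrec : ℕ → ℕ → ℕ → ℕ
wfPrec db a r = andN (eqN a (suc (fstP db)))
                (andN (memKey (wfKey (fstP (sndP db)) (fstP db)) r)
                      (memKey (wfKey (sndP (sndP db)) (suc (suc (fstP db)))) r))
wfPrecᶜ : Computable 3 (uncurry₃ wfPrec)
wfPrecᶜ = fromExpr
  (call₂ andᶜ (call₂ eqᶜ x₁ (call₁ sucᶜ (call₁ fstᶜ x₀)))
  (call₂ andᶜ (call₂ memKeyᶜ (call₂ wfKeyᶜ (call₁ fstᶜ (call₁ sndᶜ x₀)) (call₁ fstᶜ x₀)) x₂)
            (call₂ memKeyᶜ (call₂ wfKeyᶜ (call₁ sndᶜ (call₁ sndᶜ x₀)) (call₁ sucᶜ (call₁ sucᶜ (call₁ fstᶜ x₀)))) x₂)))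
  λ { (_ ∷ _ ∷ _ ∷ []) → refl }

wfMu : ℕ → ℕ → ℕ → ℕ
wfMu db a r = andN (eqN (fstP db) a) (memKey (wfKey (sndP db) (suc (fstP db))) r)
wfMuᶜ : Computable 3 (uncurry₃ wfMu)
wfMuᶜ = fromExpr (call₂ andᶜ (call₂ eqᶜ (call₁ fstᶜ x₀) x₁) (call₂ memKeyᶜ (call₂ wfKeyᶜ (call₁ sndᶜ x₀) (call₁ sucᶜ (call₁ fstᶜ x₀))) x₂))
  λ { (_ ∷ _ ∷ _ ∷ []) → refl }

wfZer : ℕ → ℕ → ℕ
wfZer n a = eqN n a

wfSuc : ℕ → ℕ → ℕ
wfSuc body a = andN (eqN body 0) (eqN a 1)

wfProj : ℕ → ℕ → ℕ
wfProj ni a = andN (eqN (fstP ni) a) (ltN (sndP ni) (fstP ni))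

wfOk : ℕ → ℕ → ℕ → ℕ
wfOk d a r = byTag (fstP d) (wfZer b a) (wfSuc b a) (wfProj b a) (wfComp b a r) (wfPrec b a r) (wfMu b a r)
  where b = sndP d
wfOkᶜ : Computable 3 (uncurry₃ wfOk)
wfOkᶜ = fromExpr
  (byTagᴱ (call₁ fstᶜ x₀) (call₂ eqᶜ B x₁) (call₂ andᶜ (call₂ eqᶜ B (lit 0)) (call₂ eqᶜ x₁ (lit 1)))
          (call₂ andᶜ (call₂ eqᶜ (call₁ fstᶜ B) x₁) (call₂ ltᶜ (call₁ sndᶜ B) (call₁ fstᶜ B)))
          (call₃ wfCompᶜ B x₁ x₂) (call₃ wfPrecᶜ B x₁ x₂) (call₃ wfMuᶜ B x₁ x₂))
  λ { (_ ∷ _ ∷ _ ∷ []) → refl }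
  where
  B : Expr 3
  B = call₁ sndᶜ x₀

entryOk : ℕ → ℕ → ℕ
entryOk J r = orN (andN (eqN (fstP (fstP J)) 0)
                    (evalOk (fstP (sndP (fstP J))) (fstP (sndP (sndP (fstP J)))) (sndP (sndP (sndP (fstP J)))) (sndP J) r))
              (andN (eqN (fstP (fstP J)) 1) (wfOk (fstP (sndP (fstP J))) (fstP (sndP (sndP (fstP J)))) r))
entryOkᶜ : Computable 2 (uncurry₂ entryOk)
entryOkᶜ = fromExpr (call₂ orᶜ (call₂ andᶜ (call₂ eqᶜ (call₁ fstᶜ KY) (lit 0))
                          (call evalOkᶜ (call₁ fstᶜ R ∷ call₁ fstᶜ (call₁ sndᶜ R) ∷ call₁ sndᶜ (call₁ sndᶜ R) ∷ call₁ sndᶜ x₀ ∷ x₁ ∷ [])))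
                        (call₂ andᶜ (call₂ eqᶜ (call₁ fstᶜ KY) (lit 1)) (call₃ wfOkᶜ (call₁ fstᶜ R) (call₁ fstᶜ (call₁ sndᶜ R)) x₁)))
               λ { (_ ∷ _ ∷ []) → refl }
  where
  KY R : Expr 2
  KY = call₁ fstᶜ x₀
  R = call₁ sndᶜ KY

entryAtHeadOk : ℕ → ℕ
entryAtHeadOk m = ifz m 1 (entryOk (hd m) (tl m))

entriesOk : ℕ → ℕ
entriesOk = allSuffixes entryAtHeadOk
entriesOkᶜ : Computable 1 (uncurry₁ entriesOk)
entriesOkᶜ = allSuffixesᶜ (fromExpr (call₃ ifzᶜ x₀ (lit 1) (call₂ entryOkᶜ (call₁ hdᶜ x₀) (call₁ tlᶜ x₀)))
                                    λ { (_ ∷ []) → refl })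

claims : ℕ → ℕ → ℕ → ℕ
claims c xs key = andN (eqN (fstP key) 0) (andN (eqN (fstP (sndP key)) c) (eqN (fstP (sndP (sndP key))) xs))

certifies : ℕ → ℕ → ℕ → ℕ
certifies c xs cert = andN cert (andN (entriesOk cert) (claims c xs (fstP (hd cert))))
certifiesᶜ : Computable 3 (uncurry₃ certifies)
certifiesᶜ = fromExpr (call₂ andᶜ x₂ (call₂ andᶜ (call₁ entriesOkᶜ x₂)
                      (call₂ andᶜ (call₂ eqᶜ (call₁ fstᶜ K) (lit 0))
                      (call₂ andᶜ (call₂ eqᶜ (call₁ fstᶜ (call₁ sndᶜ K)) x₀) (call₂ eqᶜ (call₁ fstᶜ (call₁ sndᶜ (call₁ sndᶜ K))) x₁)))))
                   λ { (_ ∷ _ ∷ _ ∷ []) → refl }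
  where
  K : Expr 3
  K = call₁ fstᶜ (call₁ hdᶜ x₂)

claims-evalKey : ∀ c xs y → Holds (claims c xs (evalKey c xs y))
claims-evalKey c xs y
  rewrite fst-pair 0 (pair c (pair xs y)) | snd-pair 0 (pair c (pair xs y)) | fst-pair c (pair xs y)
        | snd-pair c (pair xs y) | fst-pair xs y = and-intro (eq-refl 0) (and-intro (eq-refl c) (eq-refl xs))

claims-elim : ∀ c xs key → Holds (claims c xs key) → key ≡ evalKey c xs (sndP (sndP (sndP key)))
claims-elim c xs key t with and-elim _ _ t
... | t₀ , t′ with and-elim _ _ t′
... | t₁ , t₂ = begin
  key                                                                  ≡⟨ pair-unpair key ⟨
  pair (fstP key) (sndP key)                                           ≡⟨ cong (pair (fstP key)) (pair-unpair (sndP key)) ⟨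
  pair (fstP key) (pair (fstP (sndP key)) (sndP (sndP key)))          ≡⟨ cong (λ u → pair (fstP key) (pair (fstP (sndP key)) u)) (pair-unpair _) ⟨
  pair (fstP key) (pair (fstP (sndP key)) (pair (fstP (sndP (sndP key))) y))
    ≡⟨ cong₃ (λ a b u → pair a (pair b (pair u y))) (eq-elim _ _ t₀) (eq-elim _ _ t₁) (eq-elim _ _ t₂) ⟩
  evalKey c xs y                                                       ∎
  where
  open ≡-Reasoning
  y = sndP (sndP (sndP key))
  cong₃ : ∀ (f : ℕ → ℕ → ℕ → ℕ) {a a′ b b′ u u′} → a ≡ a′ → b ≡ b′ → u ≡ u′ → f a b u ≡ f a′ b′ u′
  cong₃ f refl refl refl = refl

tagOf : ∀ {n} → PR n → ℕ
tagOf zer = 0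
tagOf succ = 1
tagOf (proj _) = 2
tagOf (comp _ _) = 3
tagOf (prec _ _) = 4
tagOf (mu _) = 5

bodyOf : ∀ {n} → PR n → ℕ
bodyOf (zer {n}) = n
bodyOf succ = 0
bodyOf (proj {n} i) = pair n (toℕ i)
bodyOf (comp {k} {n} f gs) = pair (pair k n) (pair (encode f) (encodeVec gs))
bodyOf (prec {n} f g) = pair n (pair (encode f) (encode g))
bodyOf (mu {n} f) = pair n (encode f)

encode-tag-body : ∀ {n} (t : PR n) → encode t ≡ pair (tagOf t) (bodyOf t)
encode-tag-body zer = refl
encode-tag-body succ = refl
encode-tag-body (proj i) = refl
encode-tag-body (comp f gs) = refl
encode-tag-body (prec f g) = refl
encode-tag-body (mu f) = refl

mutual
  encode-injective : ∀ {n} (t t' : PR n) → encode t ≡ encode t' → t ≡ t'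
  encode-injective t t' e =
    let e₁ , e₂ = pair-injective (trans (sym (encode-tag-body t)) (trans e (encode-tag-body t')))
    in tag-body-injective t t' e₁ e₂

  tag-body-injective : ∀ {n} (t t' : PR n) → tagOf t ≡ tagOf t' → bodyOf t ≡ bodyOf t' → t ≡ t'
  tag-body-injective zer zer refl _ = refl
  tag-body-injective succ succ refl _ = refl
  tag-body-injective (proj {n} i) (proj i') refl e = cong proj (toℕ-injective (proj₂ (pair-injective {n} {toℕ i} {n} e)))
  tag-body-injective (comp {k} {n} f gs) (comp {k'} f' gs') refl e
    with pair-injective {pair k n} {pair (encode f) (encodeVec gs)} {pair k' n} {pair (encode f') (encodeVec gs')} e
  ... | e₁ , e₂ with pair-injective {k} {n} {k'} {n} e₁ | pair-injective {encode f} {encodeVec gs} {encode f'} {encodeVec gs'} e₂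
  ... | refl , _ | e₃ , e₄ = cong₂ comp (encode-injective f f' e₃) (encodeVec-injective gs gs' e₄)
  tag-body-injective (prec {n} f g) (prec f' g') refl e =
    let e₁ , e₂ = pair-injective (proj₂ (pair-injective {n} {_} {n} e))
    in cong₂ prec (encode-injective f f' e₁) (encode-injective g g' e₂)
  tag-body-injective (mu {n} f) (mu f') refl e = cong mu (encode-injective f f' (proj₂ (pair-injective {n} {_} {n} e)))

  encodeVec-injective : ∀ {k n} (gs gs' : Vec (PR n) k) → encodeVec gs ≡ encodeVec gs' → gs ≡ gs'
  encodeVec-injective [] [] e = refl
  encodeVec-injective (g ∷ gs) (g' ∷ gs') e =
    let e₁ , e₂ = pair-injective (suc-injective e)
    in cong₂ _∷_ (encode-injective g g' e₁) (encodeVec-injective gs gs' e₂)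

EvalCode : ℕ → ℕ → ℕ → Set
EvalCode c xs y = Σ (List ℕ) λ L → listCode L ≡ xs × Σ (PR (length L)) λ t → encode t ≡ c × Eval t (fromList L) y

WfCode : ℕ → ℕ → Set
WfCode d a = Σ (PR a) λ t → encode t ≡ d

EntriesSound : List ℕ → Set
EntriesSound R = (∀ c xs y → Holds (memKey (evalKey c xs y) (listCode R)) → EvalCode c xs y) × (∀ d a → Holds (memKey (wfKey d a) (listCode R)) → WfCode d a)

pair-fstP : ∀ c t → fstP c ≡ t → pair t (sndP c) ≡ c
pair-fstP c t e = trans (cong (λ z → pair z (sndP c)) (sym e)) (pair-unpair c)

length-1 : ∀ (L : List ℕ) → length L ≡ 1 → Σ ℕ λ x → L ≡ x ∷ []
length-1 (x ∷ []) _ = x , refl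
length-1 [] ()
length-1 (x ∷ y ∷ L) ()

length-suc : ∀ (L : List ℕ) n → length L ≡ suc n → Σ ℕ λ x → Σ (List ℕ) λ L' → L ≡ x ∷ L' × length L' ≡ n
length-suc (x ∷ L) n e = x , L , refl , suc-injective e
length-suc [] n ()

lookup-fromList : ∀ L j (p : j < length L) → lookup (fromList L) (fromℕ< p) ≡ at L j
lookup-fromList (x ∷ L) zero p = refl
lookup-fromList (x ∷ L) (suc j) (s≤s p) = lookup-fromList L j p

encode-subst : ∀ {m m'} (e : m ≡ m') (t : PR m) → encode (subst PR e t) ≡ encode t
encode-subst refl t = refl

EvalCode-list : ∀ {c L y} → EvalCode c (listCode L) y → Σ (PR (length L)) λ t → encode t ≡ c × Eval t (fromList L) y
EvalCode-list (L' , e , t , et , ev) with listCode-injective e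
... | refl = t , et , ev

evalCodes→terms : ∀ L (Ly Lg : List ℕ) → length Lg ≡ length Ly → (∀ j → j < length Ly → EvalCode (at Lg j) (listCode L) (at Ly j)) →
          Σ (Vec (PR (length L)) (length Ly)) λ gs → encodeVec gs ≡ listCode Lg × EvalVec gs (fromList L) (fromList Ly)
evalCodes→terms L [] [] _ h = [] , refl , []
evalCodes→terms L (y ∷ Ly) (g ∷ Lg) e h with EvalCode-list (h 0 (s≤s z≤n)) | evalCodes→terms L Ly Lg (suc-injective e) (λ j lt → h (suc j) (s≤s lt))
... | (t , et , ev) | (gs , egs , evs) = t ∷ gs , cong suc (cong₂ pair et egs) , ev ∷ evs
evalCodes→terms L [] (_ ∷ _) () h
evalCodes→terms L (_ ∷ _) [] () h

wfCodes→terms : ∀ a (Lg : List ℕ) → (∀ j → j < length Lg → WfCode (at Lg j) a) →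
          Σ (Vec (PR a) (length Lg)) λ gs → encodeVec gs ≡ listCode Lg
wfCodes→terms a [] h = [] , refl
wfCodes→terms a (g ∷ Lg) h with h 0 (s≤s z≤n) | wfCodes→terms a Lg (λ j lt → h (suc j) (s≤s lt))
... | (t , et) | (gs , egs) = t ∷ gs , cong suc (cong₂ pair et egs)

evalOk-zer-sound : ∀ c L y → fstP c ≡ 0 → Holds (zerOk (sndP c) (listCode L) y) → EvalCode c (listCode L) y
evalOk-zer-sound c L y e t with and-elim _ _ t
... | (t1 , t2) = L , refl , zer , trans (cong (pair 0) (hasLength-elim L _ t1)) (pair-fstP c 0 e) ,
                  subst (Eval zer (fromList L)) (sym (eq-elim y 0 t2)) ev-zer

evalOk-succ-sound : ∀ c L y → fstP c ≡ 1 → Holds (sucOk (sndP c) (listCode L) y) → EvalCode c (listCode L) y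
evalOk-succ-sound c L y e t with and-elim _ _ t
... | (t1 , t2) with and-elim _ _ t2
...   | (t3 , t4) with length-1 L (hasLength-elim L 1 t3)
...     | (x , refl) = (x ∷ []) , refl , succ , trans (cong (pair 1) (sym (eq-elim _ 0 t1))) (pair-fstP c 1 e) ,
                       subst (Eval succ (x ∷ [])) (sym (trans (eq-elim _ _ t4) (cong suc (hd-cons x 0)))) ev-succ

evalOk-proj-sound : ∀ c L y → fstP c ≡ 2 → Holds (projOk (sndP c) (listCode L) y) → EvalCode c (listCode L) y
evalOk-proj-sound c L y e t with and-elim _ _ t
... | (t1 , t2) with and-elim _ _ t2
...   | (t3 , t4) = L , refl , proj (fromℕ< lt) ,
          trans (cong (λ z → pair 2 (pair (length L) z)) (toℕ-fromℕ< lt))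
           (trans (cong (λ z → pair 2 (pair z (sndP (sndP c)))) nL) (trans (cong (pair 2) (pair-unpair (sndP c))) (pair-fstP c 2 e))) ,
          subst (Eval (proj (fromℕ< lt)) (fromList L)) (sym (trans (eq-elim _ _ t4) (nth-listCode L _))) (subst (λ z → Eval (proj (fromℕ< lt)) (fromList L) z) (lookup-fromList L _ lt) ev-proj)
  where
  nL : length L ≡ fstP (sndP c)
  nL = hasLength-elim L _ t1
  lt : sndP (sndP c) < length L
  lt = subst (sndP (sndP c) <_) (sym nL) (lt-elim _ _ t3)

evalOk-comp-sound : ∀ c L y w R → EntriesSound R → fstP c ≡ 3 → Holds (compOk (sndP c) (listCode L) y w (listCode R)) → EvalCode c (listCode L) y
evalOk-comp-sound c L y w R M e t with and-elim _ _ t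
... | (t1 , t2') with and-elim _ _ t2'
... | (t2 , t3') with and-elim _ _ t3'
... | (t3 , t4') with and-elim _ _ t4'
... | (t4 , t5) with listCode-surjective w | listCode-surjective (sndP (sndP (sndP c)))
... | (Ly , eLy) | (Lg , eLg) = L , refl , comp tf gs , enc , ev-comp evs evf
  where
  b = sndP c
  k = fstP (fstP b)
  n = sndP (fstP b)
  cf = fstP (sndP b)
  cgs = sndP (sndP b)
  lenLy : length Ly ≡ k
  lenLy = hasLength-elim Ly k (subst (λ z → Holds (hasLength z k)) (sym eLy) t2)
  lenLg : length Lg ≡ k
  lenLg = hasLength-elim Lg k (subst (λ z → Holds (hasLength z k)) (sym eLg) t3)
  nL : length L ≡ n
  nL = hasLength-elim L n t1
  F = EvalCode-list {cf} {Ly} {y} (subst (λ z → EvalCode cf z y) (sym eLy) (proj₁ M cf w y t4))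
  tf = proj₁ F
  etf = proj₁ (proj₂ F)
  evf = proj₂ (proj₂ F)
  hj : ∀ j → j < length Ly → EvalCode (at Lg j) (listCode L) (at Ly j)
  hj j lt = subst₂ (λ u v → EvalCode u (listCode L) v)
              (trans (cong (λ z → nth z j) (sym eLg)) (nth-listCode Lg j))
              (trans (cong (λ z → nth z j) (sym eLy)) (nth-listCode Ly j))
              (proj₁ M _ _ _ (allBelow-elim k _ t5 j (subst (j <_) lenLy lt)))
  G = evalCodes→terms L Ly Lg (trans lenLg (sym lenLy)) hj
  gs = proj₁ G
  egs = proj₁ (proj₂ G)
  evs = proj₂ (proj₂ G)
  enc : pair 3 (pair (pair (length Ly) (length L)) (pair (encode tf) (encodeVec gs))) ≡ c
  enc = trans (cong₂ (λ u v → pair 3 (pair u v)) (trans (cong₂ pair lenLy nL) (pair-unpair (fstP b)))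
                                                 (trans (cong₂ pair etf (trans egs eLg)) (pair-unpair (sndP b))))
              (trans (cong (pair 3) (pair-unpair b)) (pair-fstP c 3 e))

tag-fstP : ∀ {n} (t : PR n) {c} → encode t ≡ c → fstP c ≡ tagOf t
tag-fstP t refl = trans (cong fstP (encode-tag-body t)) (fst-pair (tagOf t) (bodyOf t))

body-sndP : ∀ {n} (t : PR n) {c} → encode t ≡ c → sndP c ≡ bodyOf t
body-sndP t refl = trans (cong sndP (encode-tag-body t)) (snd-pair (tagOf t) (bodyOf t))

encode-subst₂ : ∀ {m m'} (e : m ≡ m') (t : PR (suc (suc m))) → encode (subst (λ z → PR (suc (suc z))) e t) ≡ encode t
encode-subst₂ refl t = refl

prec-inversion : ∀ {m} (t : PR (suc m)) (g : PR (suc (suc m))) →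
                 tagOf t ≡ 4 → encode g ≡ sndP (sndP (bodyOf t)) → Σ (PR m) λ f → t ≡ prec f g
prec-inversion (prec {m} f g′) g refl eg =
  f , cong (prec f) (encode-injective g′ g (sym (trans eg (trans (cong sndP (snd-pair m _)) (snd-pair (encode f) (encode g′))))))

evalOk-prec-sound′ : ∀ c x L' y w R → EntriesSound R → fstP c ≡ 4 → length L' ≡ fstP (sndP c) →
  Holds (ifz x (andN (memKey (evalKey (fstP (sndP (sndP c))) (listCode L') y) (listCode R)) (memKey (wfKey (sndP (sndP (sndP c))) (suc (suc (fstP (sndP c))))) (listCode R)))
            (andN (memKey (evalKey c (cons (pred x) (listCode L')) w) (listCode R)) (memKey (evalKey (sndP (sndP (sndP c))) (cons (pred x) (cons w (listCode L'))) y) (listCode R)))) →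
  EvalCode c (listCode (x ∷ L')) y
evalOk-prec-sound′ c zero L' y w R M e nL t with ifz-elim 0 _ _ t
... | inj₂ (() , _)
... | inj₁ (_ , t') with and-elim _ _ t'
... | (m1 , m2) = (0 ∷ L') , refl , prec tf tg' , enc , ev-prec0 evf
  where
  b = sndP c
  F = EvalCode-list {L = L'} (proj₁ M (fstP (sndP (sndP c))) (listCode L') y m1)
  tf = proj₁ F
  evf = proj₂ (proj₂ F)
  Gw = proj₂ M (sndP (sndP (sndP c))) (suc (suc (fstP (sndP c)))) m2
  tg' = subst (λ z → PR (suc (suc z))) (sym nL) (proj₁ Gw)
  enc : pair 4 (pair (length L') (pair (encode tf) (encode tg'))) ≡ c
  enc = trans (cong₂ (λ u v → pair 4 (pair u v)) nL
                 (trans (cong₂ pair (proj₁ (proj₂ F)) (trans (encode-subst₂ (sym nL) (proj₁ Gw)) (proj₂ Gw))) (pair-unpair (sndP b))))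
              (trans (cong (pair 4) (pair-unpair b)) (pair-fstP c 4 e))
evalOk-prec-sound′ c (suc x) L' y w R M e nL t with ifz-elim (suc x) _ _ t
... | inj₁ (() , _)
... | inj₂ (_ , t') with and-elim _ _ t'
... | (mA , mB) with EvalCode-list {L = x ∷ L'} (proj₁ M c (cons x (listCode L')) w mA) | EvalCode-list {L = x ∷ w ∷ L'} (proj₁ M (sndP (sndP (sndP c))) (cons x (cons w (listCode L'))) y mB)
... | (t1 , et1 , ev1) | (tg , etg , evg)
    with prec-inversion t1 tg (trans (sym (tag-fstP t1 et1)) e) (trans etg (cong (λ z → sndP (sndP z)) (body-sndP t1 et1)))
... | (f , refl) = (suc x ∷ L') , refl , prec f tg , et1 , ev-precS ev1 evg

evalOk-prec-sound : ∀ c L y w R → EntriesSound R → fstP c ≡ 4 → Holds (precOk c (sndP c) (listCode L) y w (listCode R)) → EvalCode c (listCode L) y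
evalOk-prec-sound c L y w R M e t with and-elim _ _ t
... | (t1 , t2) with length-suc L (fstP (sndP c)) (hasLength-elim L (suc (fstP (sndP c))) t1)
... | (x , L' , refl , nL) =
  evalOk-prec-sound′ c x L' y w R M e nL
    (subst₂ (λ h u → Holds (ifz h (andN (memKey (evalKey (fstP (sndP (sndP c))) u y) (listCode R)) (memKey (wfKey (sndP (sndP (sndP c))) (suc (suc (fstP (sndP c))))) (listCode R)))
            (andN (memKey (evalKey c (cons (pred h) u) w) (listCode R)) (memKey (evalKey (sndP (sndP (sndP c))) (cons (pred h) (cons w u)) y) (listCode R)))))
            (hd-cons x (listCode L')) (tl-cons x (listCode L')) t2)

evalOk-mu-sound : ∀ c L y w R → EntriesSound R → fstP c ≡ 5 → Holds (muOk (sndP c) (listCode L) y w (listCode R)) → EvalCode c (listCode L) y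
evalOk-mu-sound c L y w R M e t with and-elim _ _ t
... | (t1 , t2') with and-elim _ _ t2'
... | (t2 , t3) with EvalCode-list {L = y ∷ L} (proj₁ M (sndP (sndP c)) (cons y (listCode L)) 0 t2)
... | (tf , etf , evf) = L , refl , mu tf , enc , ev-mu evf hz
  where
  b = sndP c
  nL : length L ≡ fstP b
  nL = hasLength-elim L _ t1
  hz : ∀ z → z < y → Σ ℕ λ v → Eval tf (z ∷ fromList L) (suc v)
  hz z lt with EvalCode-list {L = z ∷ L} (proj₁ M (sndP (sndP c)) (cons z (listCode L)) (suc (nth w z)) (allBelow-elim y _ t3 z lt))
  ... | (tz , etz , evz) with encode-injective tz tf (trans etz (sym etf))
  ... | refl = nth w z , evz
  enc : pair 5 (pair (length L) (encode tf)) ≡ c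
  enc = trans (cong₂ (λ u v → pair 5 (pair u v)) nL etf) (trans (cong (pair 5) (pair-unpair b)) (pair-fstP c 5 e))

module _ (d a : ℕ) where

  wfOk-zer-sound : fstP d ≡ 0 → Holds (wfZer (sndP d) a) → WfCode d a
  wfOk-zer-sound e t = zer , trans (cong (pair 0) (sym (eq-elim _ _ t))) (pair-fstP d 0 e)

  wfOk-succ-sound : fstP d ≡ 1 → Holds (wfSuc (sndP d) a) → WfCode d a
  wfOk-succ-sound e t with and-elim _ _ t
  ... | t₀ , t₁ with eq-elim a 1 t₁
  ... | refl = succ , trans (cong (pair 1) (sym (eq-elim _ _ t₀))) (pair-fstP d 1 e)

  wfOk-proj-sound : fstP d ≡ 2 → Holds (wfProj (sndP d) a) → WfCode d a
  wfOk-proj-sound e t with and-elim _ _ t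
  ... | ea , el = proj (fromℕ< lt) ,
       trans (cong₂ (λ u v → pair 2 (pair u v)) (sym na) (toℕ-fromℕ< lt))
             (trans (cong (pair 2) (pair-unpair (sndP d))) (pair-fstP d 2 e))
    where
    na : fstP (sndP d) ≡ a
    na = eq-elim _ _ ea
    lt : sndP (sndP d) < a
    lt = subst (sndP (sndP d) <_) na (lt-elim _ _ el)

  module _ (R : List ℕ) (M : EntriesSound R) where

    wfOk-comp-sound : fstP d ≡ 3 → Holds (wfComp (sndP d) a (listCode R)) → WfCode d a
    wfOk-comp-sound e t with and-elim _ _ t
    ... | ea , t′ with and-elim _ _ t′
    ... | mf , t″ with and-elim _ _ t″
    ... | il , ag with listCode-surjective (sndP (sndP (sndP d)))
    ... | Lg , eLg = comp tf gs , enc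
      where
      b = sndP d
      k = fstP (fstP b)
      lenLg : length Lg ≡ k
      lenLg = hasLength-elim Lg k (subst (λ z → Holds (hasLength z k)) (sym eLg) il)
      F = proj₂ M (fstP (sndP b)) k mf
      tf = subst PR (sym lenLg) (proj₁ F)
      G = wfCodes→terms a Lg (λ j lt → subst (λ u → WfCode u a) (trans (cong (λ z → nth z j) (sym eLg)) (nth-listCode Lg j))
                                  (proj₂ M (nth (sndP (sndP b)) j) a (allBelow-elim k _ ag j (subst (j <_) lenLg lt))))
      gs = proj₁ G
      enc : pair 3 (pair (pair (length Lg) a) (pair (encode tf) (encodeVec gs))) ≡ d
      enc = trans (cong₂ (λ u v → pair 3 (pair u v)) (trans (cong₂ pair lenLg (sym (eq-elim _ _ ea))) (pair-unpair (fstP b)))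
                     (trans (cong₂ pair (trans (encode-subst (sym lenLg) (proj₁ F)) (proj₂ F)) (trans (proj₂ G) eLg)) (pair-unpair (sndP b))))
                  (trans (cong (pair 3) (pair-unpair b)) (pair-fstP d 3 e))

    wfOk-prec-sound : fstP d ≡ 4 → Holds (wfPrec (sndP d) a (listCode R)) → WfCode d a
    wfOk-prec-sound e t with and-elim _ _ t
    ... | ea , t′ with and-elim _ _ t′
    ... | mf , mg with eq-elim a _ ea
    ... | refl = prec (proj₁ F) (proj₁ G) ,
         trans (cong (λ v → pair 4 (pair (fstP b) v)) (trans (cong₂ pair (proj₂ F) (proj₂ G)) (pair-unpair (sndP b))))
               (trans (cong (pair 4) (pair-unpair b)) (pair-fstP d 4 e))
      where
      b = sndP d
      F = proj₂ M (fstP (sndP b)) (fstP b) mf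
      G = proj₂ M (sndP (sndP b)) (suc (suc (fstP b))) mg

    wfOk-mu-sound : fstP d ≡ 5 → Holds (wfMu (sndP d) a (listCode R)) → WfCode d a
    wfOk-mu-sound e t with and-elim _ _ t
    ... | ea , mf = subst PR na (mu (proj₁ F)) ,
         trans (encode-subst na (mu (proj₁ F)))
           (trans (cong (λ v → pair 5 (pair (fstP b) v)) (proj₂ F))
             (trans (cong (pair 5) (pair-unpair b)) (pair-fstP d 5 e)))
      where
      b = sndP d
      na : fstP b ≡ a
      na = eq-elim _ _ ea
      F = proj₂ M (sndP b) (suc (fstP b)) mf

wfOk-sound : ∀ d a R → EntriesSound R → Holds (wfOk d a (listCode R)) → WfCode d a
wfOk-sound d a R M = byTag-elim (fstP d) (wfOk-zer-sound d a) (wfOk-succ-sound d a) (wfOk-proj-sound d a)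
                                (wfOk-comp-sound d a R M) (wfOk-prec-sound d a R M) (wfOk-mu-sound d a R M)

evalOk-sound : ∀ c L y w R → EntriesSound R → Holds (evalOk c (listCode L) y w (listCode R)) → EvalCode c (listCode L) y
evalOk-sound c L y w R M =
  byTag-elim (fstP c) (evalOk-zer-sound c L y) (evalOk-succ-sound c L y) (evalOk-proj-sound c L y)
                      (evalOk-comp-sound c L y w R M) (evalOk-prec-sound c L y w R M) (evalOk-mu-sound c L y w R M)

keyOk : ℕ → ℕ → ℕ → ℕ
keyOk key w r = orN (andN (eqN (fstP key) 0) (evalOk (fstP (sndP key)) (fstP (sndP (sndP key))) (sndP (sndP (sndP key))) w r))
                 (andN (eqN (fstP key) 1) (wfOk (fstP (sndP key)) (fstP (sndP (sndP key))) r))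

keyOk-evalKey : ∀ c xs y w r → keyOk (evalKey c xs y) w r ≡ orN (andN (eqN 0 0) (evalOk c xs y w r)) (andN (eqN 0 1) (wfOk c xs r))
keyOk-evalKey c xs y w r rewrite fst-pair 0 (pair c (pair xs y)) | snd-pair 0 (pair c (pair xs y)) | fst-pair c (pair xs y)
  | snd-pair c (pair xs y) | fst-pair xs y | snd-pair xs y = refl

keyOk-wfKey : ∀ d a w r → keyOk (wfKey d a) w r ≡ orN (andN (eqN 1 0) (evalOk d a 0 w r)) (andN (eqN 1 1) (wfOk d a r))
keyOk-wfKey d a w r rewrite fst-pair 1 (pair d (pair a 0)) | snd-pair 1 (pair d (pair a 0)) | fst-pair d (pair a 0)
  | snd-pair d (pair a 0) | fst-pair a 0 | snd-pair a 0 = refl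

KeySound : ℕ → Set
KeySound key = (∀ c xs y → key ≡ evalKey c xs y → EvalCode c xs y) × (∀ d a → key ≡ wfKey d a → WfCode d a)

entryOk-sound : ∀ J R → EntriesSound R → Holds (entryOk J (listCode R)) → KeySound (fstP J)
entryOk-sound J R M t = gk , gw
  where
  gk : ∀ c xs y → fstP J ≡ evalKey c xs y → EvalCode c xs y
  gk c xs y e with listCode-surjective xs
  ... | (L , refl) with or-elim _ _ (subst Holds (trans (cong (λ z → keyOk z (sndP J) (listCode R)) e) (keyOk-evalKey c (listCode L) y (sndP J) (listCode R))) t)
  ... | inj₁ t1 = evalOk-sound c L y (sndP J) R M (proj₂ (and-elim _ _ t1))
  ... | inj₂ t2 with eq-elim 0 1 (proj₁ (and-elim _ _ t2))
  ... | ()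
  gw : ∀ d a → fstP J ≡ wfKey d a → WfCode d a
  gw d a e with or-elim _ _ (subst Holds (trans (cong (λ z → keyOk z (sndP J) (listCode R)) e) (keyOk-wfKey d a (sndP J) (listCode R))) t)
  ... | inj₂ t2 = wfOk-sound d a R M (proj₂ (and-elim _ _ t2))
  ... | inj₁ t1 with eq-elim 1 0 (proj₁ (and-elim _ _ t1))
  ... | ()

data AllEntriesOk : List ℕ → Set where
  [] : AllEntriesOk []
  _∷_ : ∀ {J R} → Holds (entryOk J (listCode R)) → AllEntriesOk R → AllEntriesOk (J ∷ R)

mutual
  allEntries-sound : ∀ {L} → AllEntriesOk L → ∀ J → J ∈ L → KeySound (fstP J)
  allEntries-sound (_∷_ {R = R} t A) J (here refl) = entryOk-sound J R (entries-sound A) t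
  allEntries-sound (t ∷ A) J (there J∈L) = allEntries-sound A J J∈L

  entries-sound : ∀ {R} → AllEntriesOk R → EntriesSound R
  entries-sound {R} A =
    (λ c xs y t → let J , J∈R , e = memKey-elim (evalKey c xs y) R t in proj₁ (allEntries-sound A J J∈R) c xs y e) ,
    (λ d a t → let J , J∈R , e = memKey-elim (wfKey d a) R t in proj₂ (allEntries-sound A J J∈R) d a e)

entryAtHeadOk-cons : ∀ J R → entryAtHeadOk (listCode (J ∷ R)) ≡ entryOk J (listCode R)
entryAtHeadOk-cons J R = trans (ifz-suc _ 1 _) (cong₂ entryOk (hd-cons J (listCode R)) (tl-cons J (listCode R)))

entriesOk-elim : ∀ L → Holds (entriesOk (listCode L)) → AllEntriesOk L
entriesOk-elim L t = go L (allSuffixes-elim entryAtHeadOk L t)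
  where
  go : ∀ M → (∀ p → p < length M → Holds (entryAtHeadOk (listCode (drop p M)))) → AllEntriesOk M
  go [] _ = []
  go (J ∷ R) h = subst Holds (entryAtHeadOk-cons J R) (h 0 (s≤s z≤n)) ∷ go R (λ p lt → h (suc p) (s≤s lt))

AllEntriesOk-drop : ∀ p {L} → AllEntriesOk L → AllEntriesOk (drop p L)
AllEntriesOk-drop zero A = A
AllEntriesOk-drop (suc p) [] = []
AllEntriesOk-drop (suc p) (_ ∷ A) = AllEntriesOk-drop p A

entriesOk-intro : ∀ L → AllEntriesOk L → Holds (entriesOk (listCode L))
entriesOk-intro L A = allSuffixes-intro entryAtHeadOk L (λ p → headOk (AllEntriesOk-drop p A))
  where
  headOk : ∀ {M} → AllEntriesOk M → Holds (entryAtHeadOk (listCode M))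
  headOk [] = ifz-zero-intro _ holds
  headOk (_∷_ {J} {R} t _) = subst Holds (sym (entryAtHeadOk-cons J R)) t

certifies-sound : ∀ c xs cert → Holds (certifies c xs cert) → Σ ℕ λ y → EvalCode c xs y
certifies-sound c xs cert t with listCode-surjective cert
... | L , refl with and-elim _ _ t
... | t₀ , t′ with L | and-elim _ _ t′
... | [] | _ = ⊥-elim (¬Holds-0 t₀)
... | J ∷ R | tentries , tclaim =
  _ , proj₁ (allEntries-sound (entriesOk-elim (J ∷ R) tentries) J (here refl)) c xs _
             (claims-elim c xs (fstP J) (subst (λ z → Holds (claims c xs (fstP z))) (hd-cons J (listCode R)) tclaim))

vecCode : ∀ {n} → Vec ℕ n → ℕ
vecCode v = listCode (toList v)

length-toList : ∀ {n} (v : Vec ℕ n) → length (toList v) ≡ n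
length-toList [] = refl
length-toList (x ∷ v) = cong suc (length-toList v)

hasLength-vecCode : ∀ {n} (v : Vec ℕ n) → Holds (hasLength (vecCode v) n)
hasLength-vecCode v = subst (λ m → Holds (hasLength (vecCode v) m)) (length-toList v) (hasLength-intro (toList v))

at-toList : ∀ {n} (v : Vec ℕ n) (i : Fin n) → at (toList v) (toℕ i) ≡ lookup v i
at-toList (x ∷ v) zero = refl
at-toList (x ∷ v) (suc i) = at-toList v i

codes : ∀ {k n} → Vec (PR n) k → List ℕ
codes [] = []
codes (g ∷ gs) = encode g ∷ codes gs

listCode-codes : ∀ {k n} (gs : Vec (PR n) k) → listCode (codes gs) ≡ encodeVec gs
listCode-codes [] = refl
listCode-codes (g ∷ gs) = cong (cons (encode g)) (listCode-codes gs)

nth-encodeVec : ∀ {k n} (gs : Vec (PR n) k) j → nth (encodeVec gs) j ≡ at (codes gs) j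
nth-encodeVec gs j = trans (cong (λ z → nth z j) (sym (listCode-codes gs))) (nth-listCode (codes gs) j)

hasLength-encodeVec : ∀ {k n} (gs : Vec (PR n) k) → Holds (hasLength (encodeVec gs) k)
hasLength-encodeVec gs = subst₂ (λ u m → Holds (hasLength u m)) (listCode-codes gs) (length-codes gs) (hasLength-intro (codes gs))
  where
  length-codes : ∀ {k n} (gs : Vec (PR n) k) → length (codes gs) ≡ k
  length-codes [] = refl
  length-codes (g ∷ gs) = cong suc (length-codes gs)

tabulateBelow : (y : ℕ) → ((z : ℕ) → z < y → ℕ) → List ℕ
tabulateBelow zero f = []
tabulateBelow (suc y) f = f 0 (s≤s z≤n) ∷ tabulateBelow y (λ z lt → f (suc z) (s≤s lt))

at-tabulateBelow : ∀ y f z (lt : z < y) → at (tabulateBelow y f) z ≡ f z lt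
at-tabulateBelow (suc y) f zero (s≤s z≤n) = refl
at-tabulateBelow (suc y) f (suc z) (s≤s lt) = at-tabulateBelow y (λ z lt → f (suc z) (s≤s lt)) z lt

evalOk-intro : ∀ tg b xs y w r →
  Holds (byTag tg (zerOk b xs y) (sucOk b xs y) (projOk b xs y) (compOk b xs y w r) (precOk (pair tg b) b xs y w r) (muOk b xs y w r)) →
  Holds (evalOk (pair tg b) xs y w r)
evalOk-intro tg b xs y w r rewrite fst-pair tg b | snd-pair tg b = λ h → h

wfOk-intro : ∀ tg b a r →
  Holds (byTag tg (wfZer b a) (wfSuc b a) (wfProj b a) (wfComp b a r) (wfPrec b a r) (wfMu b a r)) →
  Holds (wfOk (pair tg b) a r)
wfOk-intro tg b a r rewrite fst-pair tg b | snd-pair tg b = λ h → h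

projOk-intro : ∀ {n} (i : Fin n) (xs : Vec ℕ n) → Holds (projOk (pair n (toℕ i)) (vecCode xs) (lookup xs i))
projOk-intro {n} i xs rewrite fst-pair n (toℕ i) | snd-pair n (toℕ i) =
  and-intro (hasLength-vecCode xs)
            (and-intro (lt-intro (toℕ<n i)) (eq-intro (sym (trans (nth-listCode (toList xs) (toℕ i)) (at-toList xs i)))))

compOk-intro : ∀ {k n} cf (gs : Vec (PR n) k) (xs : Vec ℕ n) (ys : Vec ℕ k) y r →
  Holds (memKey (evalKey cf (vecCode ys) y) r) →
  (∀ j → j < k → Holds (memKey (evalKey (at (codes gs) j) (vecCode xs) (at (toList ys) j)) r)) →
  Holds (compOk (pair (pair k n) (pair cf (encodeVec gs))) (vecCode xs) y (vecCode ys) r)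
compOk-intro {k} {n} cf gs xs ys y r hf hgs
  rewrite fst-pair (pair k n) (pair cf (encodeVec gs)) | snd-pair (pair k n) (pair cf (encodeVec gs))
        | fst-pair k n | snd-pair k n | fst-pair cf (encodeVec gs) | snd-pair cf (encodeVec gs) =
  and-intro (hasLength-vecCode xs) (and-intro (hasLength-vecCode ys) (and-intro (hasLength-encodeVec gs) (and-intro hf
    (allBelow-intro k _ λ j lt →
       subst₂ (λ u v → Holds (memKey (evalKey u (vecCode xs) v) r))
              (sym (nth-encodeVec gs j)) (sym (nth-listCode (toList ys) j)) (hgs j lt)))))

precOk-zero-intro : ∀ n cf cg xs y w r →
  Holds (memKey (evalKey cf (vecCode xs) y) r) → Holds (memKey (wfKey cg (suc (suc n))) r) →
  Holds (precOk (pair 4 (pair n (pair cf cg))) (pair n (pair cf cg)) (vecCode (0 ∷ xs)) y w r)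
precOk-zero-intro n cf cg xs y w r hf hg
  rewrite fst-pair n (pair cf cg) | snd-pair n (pair cf cg) | fst-pair cf cg | snd-pair cf cg
        | hd-cons 0 (vecCode xs) | tl-cons 0 (vecCode xs) =
  and-intro (hasLength-vecCode (0 ∷ xs)) (ifz-zero-intro _ (and-intro hf hg))

precOk-suc-intro : ∀ n cf cg x xs y w r →
  Holds (memKey (evalKey (pair 4 (pair n (pair cf cg))) (vecCode (x ∷ xs)) w) r) →
  Holds (memKey (evalKey cg (vecCode (x ∷ w ∷ xs)) y) r) →
  Holds (precOk (pair 4 (pair n (pair cf cg))) (pair n (pair cf cg)) (vecCode (suc x ∷ xs)) y w r)
precOk-suc-intro n cf cg x xs y w r hrec hg
  rewrite fst-pair n (pair cf cg) | snd-pair n (pair cf cg) | fst-pair cf cg | snd-pair cf cg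
        | hd-cons (suc x) (vecCode xs) | tl-cons (suc x) (vecCode xs) =
  and-intro (hasLength-vecCode (suc x ∷ xs)) (ifz-suc-intro x _ (and-intro hrec hg))

muOk-intro : ∀ {n} cf (xs : Vec ℕ n) y (vs : ∀ z → z < y → ℕ) r →
  Holds (memKey (evalKey cf (vecCode (y ∷ xs)) 0) r) →
  (∀ z (lt : z < y) → Holds (memKey (evalKey cf (vecCode (z ∷ xs)) (suc (vs z lt))) r)) →
  Holds (muOk (pair n cf) (vecCode xs) y (listCode (tabulateBelow y vs)) r)
muOk-intro {n} cf xs y vs r hroot hbelow rewrite fst-pair n cf | snd-pair n cf =
  and-intro (hasLength-vecCode xs) (and-intro hroot (allBelow-intro y _ λ z lt →
    subst (λ u → Holds (memKey (evalKey cf (cons z (vecCode xs)) (suc u)) r))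
          (sym (trans (nth-listCode (tabulateBelow y vs) z) (at-tabulateBelow y vs z lt))) (hbelow z lt)))

wfProj-intro : ∀ {n} (i : Fin n) → Holds (wfProj (pair n (toℕ i)) n)
wfProj-intro {n} i rewrite fst-pair n (toℕ i) | snd-pair n (toℕ i) = and-intro (eq-refl n) (lt-intro (toℕ<n i))

wfComp-intro : ∀ {k n} cf (gs : Vec (PR n) k) r →
  Holds (memKey (wfKey cf k) r) → (∀ j → j < k → Holds (memKey (wfKey (at (codes gs) j) n) r)) →
  Holds (wfComp (pair (pair k n) (pair cf (encodeVec gs))) n r)
wfComp-intro {k} {n} cf gs r hf hgs
  rewrite fst-pair (pair k n) (pair cf (encodeVec gs)) | snd-pair (pair k n) (pair cf (encodeVec gs))
        | fst-pair k n | snd-pair k n | fst-pair cf (encodeVec gs) | snd-pair cf (encodeVec gs) =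
  and-intro (eq-refl n) (and-intro hf (and-intro (hasLength-encodeVec gs)
    (allBelow-intro k _ λ j lt → subst (λ u → Holds (memKey (wfKey u n) r)) (sym (nth-encodeVec gs j)) (hgs j lt))))

wfPrec-intro : ∀ n cf cg r → Holds (memKey (wfKey cf n) r) → Holds (memKey (wfKey cg (suc (suc n))) r) →
  Holds (wfPrec (pair n (pair cf cg)) (suc n) r)
wfPrec-intro n cf cg r hf hg rewrite fst-pair n (pair cf cg) | snd-pair n (pair cf cg) | fst-pair cf cg | snd-pair cf cg =
  and-intro (eq-refl (suc n)) (and-intro hf hg)

wfMu-intro : ∀ n cf r → Holds (memKey (wfKey cf (suc n)) r) → Holds (wfMu (pair n cf) n r)
wfMu-intro n cf r hf rewrite fst-pair n cf | snd-pair n cf = and-intro (eq-refl n) hf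

ExtendedBy : List ℕ → ℕ → Set
ExtendedBy R key = Σ ℕ λ J → Σ (List ℕ) λ R′ → AllEntriesOk (J ∷ R′) × R ⊆ J ∷ R′ × fstP J ≡ key

Extension : List ℕ → (List ℕ → Set) → Set
Extension R P = Σ (List ℕ) λ R′ → AllEntriesOk R′ × R ⊆ R′ × P R′

HasKey-mono : ∀ {R R′ key} → R ⊆ R′ → HasKey key R → HasKey key R′
HasKey-mono s (J , J∈R , e) = J , s J∈R , e

ExtendedBy-weaken : ∀ {R R′ key} → R ⊆ R′ → ExtendedBy R′ key → ExtendedBy R key
ExtendedBy-weaken s (J , R″ , A , s′ , e) = J , R″ , A , s′ ∘ s , e

push-eval : ∀ tg b xs y w R → AllEntriesOk R →
  Holds (byTag tg (zerOk b xs y) (sucOk b xs y) (projOk b xs y)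
                  (compOk b xs y w (listCode R)) (precOk (pair tg b) b xs y w (listCode R)) (muOk b xs y w (listCode R))) →
  ExtendedBy R (evalKey (pair tg b) xs y)
push-eval tg b xs y w R A t = pair key w , R , ok ∷ A , there , fst-pair key w
  where
  key = evalKey (pair tg b) xs y
  ok : Holds (entryOk (pair key w) (listCode R))
  ok = subst Holds (sym (trans (cong₂ (λ u v → keyOk u v (listCode R)) (fst-pair key w) (snd-pair key w))
                               (keyOk-evalKey (pair tg b) xs y w (listCode R))))
             (or-introˡ _ (and-intro (eq-refl 0) (evalOk-intro tg b xs y w (listCode R) t)))

push-wf : ∀ tg b a R → AllEntriesOk R →
  Holds (byTag tg (wfZer b a) (wfSuc b a) (wfProj b a) (wfComp b a (listCode R)) (wfPrec b a (listCode R)) (wfMu b a (listCode R))) →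
  ExtendedBy R (wfKey (pair tg b) a)
push-wf tg b a R A t = pair key 0 , R , ok ∷ A , there , fst-pair key 0
  where
  key = wfKey (pair tg b) a
  ok : Holds (entryOk (pair key 0) (listCode R))
  ok = subst Holds (sym (trans (cong₂ (λ u v → keyOk u v (listCode R)) (fst-pair key 0) (snd-pair key 0))
                               (keyOk-wfKey (pair tg b) a 0 (listCode R))))
             (or-introʳ _ (and-intro (eq-refl 1) (wfOk-intro tg b a (listCode R) t)))

-- Entries are added in dependency order: each new entry is justified by the list built so far.
mutual
  wf-certified : ∀ {a} (t : PR a) R → AllEntriesOk R → ExtendedBy R (wfKey (encode t) a)
  wf-certified (zer {a}) R A = push-wf 0 a a R A (byTag-intro₀ (eq-refl a))
  wf-certified succ R A = push-wf 1 0 1 R A (byTag-intro₁ (and-intro (eq-refl 0) (eq-refl 1)))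
  wf-certified (proj {n} i) R A = push-wf 2 (pair n (toℕ i)) n R A (byTag-intro₂ (wfProj-intro i))
  wf-certified (comp {k} {n} f gs) R A with wf-certified f R A
  ... | J₁ , R₁ , A₁ , s₁ , e₁ with wfVec-certified gs (J₁ ∷ R₁) A₁
  ... | R₂ , A₂ , s₂ , hgs = ExtendedBy-weaken (s₂ ∘ s₁) $ push-wf 3 _ n R₂ A₂ $ byTag-intro₃ $
        wfComp-intro (encode f) gs (listCode R₂) (memKey-intro _ R₂ (HasKey-mono s₂ (J₁ , here refl , e₁)))
                     (λ j lt → memKey-intro _ R₂ (hgs j lt))
  wf-certified (prec {n} f g) R A with wf-certified f R A
  ... | J₁ , R₁ , A₁ , s₁ , e₁ with wf-certified g (J₁ ∷ R₁) A₁
  ... | J₂ , R₂ , A₂ , s₂ , e₂ = ExtendedBy-weaken (s₂ ∘ s₁) $ push-wf 4 _ (suc n) (J₂ ∷ R₂) A₂ $ byTag-intro₄ $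
        wfPrec-intro n (encode f) (encode g) (listCode (J₂ ∷ R₂))
                     (memKey-intro _ (J₂ ∷ R₂) (HasKey-mono s₂ (J₁ , here refl , e₁))) (memKey-intro _ (J₂ ∷ R₂) (J₂ , here refl , e₂))
  wf-certified (mu {n} f) R A with wf-certified f R A
  ... | J₁ , R₁ , A₁ , s₁ , e₁ = ExtendedBy-weaken s₁ $ push-wf 5 _ n (J₁ ∷ R₁) A₁ $ byTag-intro₅ $
        wfMu-intro n (encode f) (listCode (J₁ ∷ R₁)) (memKey-intro _ (J₁ ∷ R₁) (J₁ , here refl , e₁))

  wfVec-certified : ∀ {k n} (gs : Vec (PR n) k) R → AllEntriesOk R →
                    Extension R (λ R′ → ∀ j → j < k → HasKey (wfKey (at (codes gs) j) n) R′)
  wfVec-certified [] R A = R , A , id , λ j ()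
  wfVec-certified (g ∷ gs) R A with wf-certified g R A
  ... | J₁ , R₁ , A₁ , s₁ , e₁ with wfVec-certified gs (J₁ ∷ R₁) A₁
  ... | R₂ , A₂ , s₂ , hgs = R₂ , A₂ , s₂ ∘ s₁ , λ where
    zero _ → HasKey-mono s₂ (J₁ , here refl , e₁)
    (suc j) (s≤s lt) → hgs j lt

mutual
  eval-certified : ∀ {n} {t : PR n} {v y} → Eval t v y → ∀ R → AllEntriesOk R → ExtendedBy R (evalKey (encode t) (vecCode v) y)
  eval-certified (ev-zer {n} {xs}) R A =
    push-eval 0 n (vecCode xs) 0 0 R A (byTag-intro₀ (and-intro (hasLength-vecCode xs) (eq-refl 0)))
  eval-certified (ev-succ {x}) R A =
    push-eval 1 0 (vecCode (x ∷ [])) (suc x) 0 R A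
      (byTag-intro₁ (and-intro (eq-refl 0) (and-intro (hasLength-vecCode (x ∷ [])) (eq-intro (cong suc (sym (hd-cons x 0)))))))
  eval-certified (ev-proj {n} {i} {xs}) R A =
    push-eval 2 (pair n (toℕ i)) (vecCode xs) (lookup xs i) 0 R A (byTag-intro₂ (projOk-intro i xs))
  eval-certified (ev-comp {k} {n} {f} {gs} {xs} {ys} {y} evs ef) R A with eval-certified ef R A
  ... | J₁ , R₁ , A₁ , s₁ , e₁ with evalVec-certified evs (J₁ ∷ R₁) A₁
  ... | R₂ , A₂ , s₂ , hgs = ExtendedBy-weaken (s₂ ∘ s₁) $ push-eval 3 _ (vecCode xs) y (vecCode ys) R₂ A₂ $ byTag-intro₃ $
        compOk-intro (encode f) gs xs ys y (listCode R₂) (memKey-intro _ R₂ (HasKey-mono s₂ (J₁ , here refl , e₁)))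
                     (λ j lt → memKey-intro _ R₂ (hgs j lt))
  eval-certified (ev-prec0 {n} {f} {g} {xs} {y} ef) R A with eval-certified ef R A
  ... | J₁ , R₁ , A₁ , s₁ , e₁ with wf-certified g (J₁ ∷ R₁) A₁
  ... | J₂ , R₂ , A₂ , s₂ , e₂ = ExtendedBy-weaken (s₂ ∘ s₁) $ push-eval 4 _ (vecCode (0 ∷ xs)) y 0 (J₂ ∷ R₂) A₂ $ byTag-intro₄ $
        precOk-zero-intro n (encode f) (encode g) xs y 0 (listCode (J₂ ∷ R₂))
          (memKey-intro _ (J₂ ∷ R₂) (HasKey-mono s₂ (J₁ , here refl , e₁))) (memKey-intro _ (J₂ ∷ R₂) (J₂ , here refl , e₂))
  eval-certified (ev-precS {n} {f} {g} {x} {xs} {w} {y} ev₁ ev₂) R A with eval-certified ev₁ R A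
  ... | J₁ , R₁ , A₁ , s₁ , e₁ with eval-certified ev₂ (J₁ ∷ R₁) A₁
  ... | J₂ , R₂ , A₂ , s₂ , e₂ = ExtendedBy-weaken (s₂ ∘ s₁) $ push-eval 4 _ (vecCode (suc x ∷ xs)) y w (J₂ ∷ R₂) A₂ $ byTag-intro₄ $
        precOk-suc-intro n (encode f) (encode g) x xs y w (listCode (J₂ ∷ R₂))
          (memKey-intro _ (J₂ ∷ R₂) (HasKey-mono s₂ (J₁ , here refl , e₁))) (memKey-intro _ (J₂ ∷ R₂) (J₂ , here refl , e₂))
  eval-certified (ev-mu {n} {f} {xs} {y} e h) R A with eval-certified e R A
  ... | J₁ , R₁ , A₁ , s₁ , e₁ with below y ≤-refl
    where
    Below : ℕ → List ℕ → Set
    Below m R′ = ∀ z (lt : z < y) → z < m → HasKey (evalKey (encode f) (vecCode (z ∷ xs)) (suc (proj₁ (h z lt)))) R′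
    below : ∀ m → m ≤ y → Extension (J₁ ∷ R₁) (Below m)
    below zero _ = J₁ ∷ R₁ , A₁ , id , λ z lt ()
    below (suc m) m<y with below m (<⇒≤ m<y)
    ... | R₂ , A₂ , s₂ , hz with eval-certified (proj₂ (h m m<y)) R₂ A₂
    ... | J₃ , R₃ , A₃ , s₃ , e₃ = J₃ ∷ R₃ , A₃ , s₃ ∘ s₂ , hz′
      where
      hz′ : Below (suc m) (J₃ ∷ R₃)
      hz′ z lt (s≤s z≤m) with m≤n⇒m<n∨m≡n z≤m
      ... | inj₁ z<m = HasKey-mono s₃ (hz z lt z<m)
      ... | inj₂ refl rewrite <-irrelevant lt m<y = J₃ , here refl , e₃
  ... | R₂ , A₂ , s₂ , hbelow = ExtendedBy-weaken (s₂ ∘ s₁) $ push-eval 5 _ (vecCode xs) y _ R₂ A₂ $ byTag-intro₅ $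
        muOk-intro (encode f) xs y (λ z lt → proj₁ (h z lt)) (listCode R₂)
          (memKey-intro _ R₂ (HasKey-mono s₂ (J₁ , here refl , e₁))) (λ z lt → memKey-intro _ R₂ (hbelow z lt lt))

  evalVec-certified : ∀ {k n} {gs : Vec (PR n) k} {v ys} → EvalVec gs v ys → ∀ R → AllEntriesOk R →
            Extension R (λ R′ → ∀ j → j < k → HasKey (evalKey (at (codes gs) j) (vecCode v) (at (toList ys) j)) R′)
  evalVec-certified [] R A = R , A , id , λ j ()
  evalVec-certified (e ∷ es) R A with eval-certified e R A
  ... | J₁ , R₁ , A₁ , s₁ , e₁ with evalVec-certified es (J₁ ∷ R₁) A₁
  ... | R₂ , A₂ , s₂ , hgs = R₂ , A₂ , s₂ ∘ s₁ , λ where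
    zero _ → HasKey-mono s₂ (J₁ , here refl , e₁)
    (suc j) (s≤s lt) → hgs j lt

certifies-complete : ∀ {n} {t : PR n} {v y} → Eval t v y → Σ ℕ λ cert → Holds (certifies (encode t) (vecCode v) cert)
certifies-complete {t = t} {v} {y} ev with eval-certified ev [] []
... | J , R , A , _ , e = listCode (J ∷ R) , and-intro holds (and-intro (entriesOk-intro (J ∷ R) A)
        (subst (λ z → Holds (claims (encode t) (vecCode v) (fstP z))) (sym (hd-cons J (listCode R)))
               (subst (Holds ∘ claims (encode t) (vecCode v)) (sym e) (claims-evalKey (encode t) (vecCode v) y))))

mutual
  eval-deterministic : ∀ {n} {t : PR n} {v y y'} → Eval t v y → Eval t v y' → y ≡ y'
  eval-deterministic ev-zer ev-zer = refl
  eval-deterministic ev-succ ev-succ = refl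
  eval-deterministic ev-proj ev-proj = refl
  eval-deterministic (ev-comp es e) (ev-comp es' e') with evalVec-deterministic es es'
  ... | refl = eval-deterministic e e'
  eval-deterministic (ev-prec0 e) (ev-prec0 e') = eval-deterministic e e'
  eval-deterministic (ev-precS e1 e2) (ev-precS e1' e2') with eval-deterministic e1 e1'
  ... | refl = eval-deterministic e2 e2'
  eval-deterministic (ev-mu {y = y} e h) (ev-mu {y = y'} e' h') with <-cmp y y'
  ... | tri≈ _ eq _ = eq
  ... | tri< lt _ _ with h' y lt
  ...   | (v , ev) with eval-deterministic e ev
  ...     | ()
  eval-deterministic (ev-mu {y = y} e h) (ev-mu {y = y'} e' h') | tri> _ _ gt with h y' gt
  ...   | (v , ev) with eval-deterministic e' ev
  ...     | ()

  evalVec-deterministic : ∀ {k n} {gs : Vec (PR n) k} {v ys ys'} → EvalVec gs v ys → EvalVec gs v ys' → ys ≡ ys'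
  evalVec-deterministic [] [] = refl
  evalVec-deterministic (e ∷ es) (e' ∷ es') = cong₂ _∷_ (eval-deterministic e e') (evalVec-deterministic es es')

least-root : (f : ℕ → ℕ) → ∀ b → (Σ ℕ λ z → z < b × f z ≡ 0 × (∀ z' → z' < z → Holds (f z'))) ⊎ (∀ z → z < b → Holds (f z))
least-root f zero = inj₂ (λ z ())
least-root f (suc b) with least-root f b
... | inj₁ (z , lt , e , h) = inj₁ (z , m≤n⇒m≤1+n lt , e , h)
... | inj₂ h with holds? (f b)
...   | inj₁ e = inj₁ (b , ≤-refl , e , h)
...   | inj₂ t = inj₂ (λ z lt → case z lt)
  where
  case : ∀ z → z < suc b → Holds (f z)
  case z (s≤s le) with m≤n⇒m<n∨m≡n le
  ... | inj₁ l = h z l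
  ... | inj₂ refl = t

mu-halts : ∀ {n} (f : PR (suc n)) (F : ℕ → ℕ) (xs : Vec ℕ n) → (∀ z → Eval f (z ∷ xs) (F z)) →
           ∀ z → F z ≡ 0 → Σ ℕ λ y → Eval (mu f) xs y × F y ≡ 0
mu-halts f F xs evalF z e with least-root F (suc z)
... | inj₂ h = ⊥-elim (¬Holds-0 (subst Holds e (h z ≤-refl)))
... | inj₁ (y , _ , ey , h) = y , ev-mu (subst (Eval f (y ∷ xs)) ey (evalF y))
          (λ z' lt → let (v , e') = holds-suc (h z' lt) in v , subst (Eval f (z' ∷ xs)) e' (evalF z')) , ey

mu-root : ∀ {n} (f : PR (suc n)) (F : ℕ → ℕ) (xs : Vec ℕ n) → (∀ z → Eval f (z ∷ xs) (F z)) →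
         ∀ {y} → Eval (mu f) xs y → F y ≡ 0
mu-root f F xs evalF (ev-mu e h) = eval-deterministic (evalF _) e

Halts : ℕ → ℕ → Set
Halts i m = Σ (PR 1) λ t → encode t ≡ i × Σ ℕ λ y → Eval t (m ∷ []) y

halts→certificate : ∀ {i m} → Halts i m → Σ ℕ λ cert → Holds (certifies i (cons m 0) cert)
halts→certificate (t , refl , y , ev) = certifies-complete ev

certificate→halts : ∀ i m cert → Holds (certifies i (cons m 0) cert) → Halts i m
certificate→halts i m cert t with certifies-sound i (cons m 0) cert t
... | (y , L , eL , t′ , et , ev) with listCode-injective {L} {m ∷ []} eL
... | refl = t′ , et , y , ev

codeℤ-injective : ∀ a b → codeℤ a ≡ codeℤ b → a ≡ b
codeℤ-injective (ℤ.+ n) (ℤ.+ m) e = cong ℤ.+_ (*-cancelˡ-≡ n m 2 e)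
codeℤ-injective (ℤ.+ n) -[1+ m ] e = ⊥-elim (even≢odd n m e)
codeℤ-injective -[1+ n ] (ℤ.+ m) e = ⊥-elim (even≢odd m n (sym e))
codeℤ-injective -[1+ n ] -[1+ m ] e = cong -[1+_] (*-cancelˡ-≡ n m 2 (suc-injective e))

decodeℤ : ℕ → ℤ
decodeℤ zero = ℤ.+ 0
decodeℤ (suc zero) = -[1+ 0 ]
decodeℤ (suc (suc m)) with decodeℤ m
... | ℤ.+ n = ℤ.+ suc n
... | -[1+ n ] = -[1+ suc n ]

codeℤ-decodeℤ : ∀ m → codeℤ (decodeℤ m) ≡ m
codeℤ-decodeℤ zero = refl
codeℤ-decodeℤ (suc zero) = refl
codeℤ-decodeℤ (suc (suc m)) with decodeℤ m | codeℤ-decodeℤ m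
... | ℤ.+ n | e = trans (*-suc 2 n) (cong (λ z → suc (suc z)) e)
... | -[1+ n ] | e = trans (cong suc (*-suc 2 n)) (cong (λ z → suc (suc z)) e)

codeStr-listCode : ∀ {k} (w : List (Fin (suc k))) → codeStr w ≡ listCode (map toℕ w)
codeStr-listCode [] = refl
codeStr-listCode (c ∷ w) = cong (cons (toℕ c)) (codeStr-listCode w)

codeStr-injective : ∀ {k} (w w' : List (Fin (suc k))) → codeStr w ≡ codeStr w' → w ≡ w'
codeStr-injective w w' e =
  map-injective toℕ-injective (listCode-injective (trans (sym (codeStr-listCode w)) (trans e (codeStr-listCode w'))))

codeSort-injective : ∀ {k} s (a b : ⟦ s ⟧ k) → codeSort s a ≡ codeSort s b → a ≡ b
codeSort-injective Nat a b e = e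
codeSort-injective Int a b e = codeℤ-injective a b e
codeSort-injective Str a b e = codeStr-injective a b e

code-injective : ∀ {k} X (x y : El k X) → code X x ≡ code X y → x ≡ y
code-injective [] tt tt e = refl
code-injective (s ∷ ss) (a , as) (b , bs) e =
  let e₁ , e₂ = pair-injective e in cong₂ _,_ (codeSort-injective s a b e₁) (code-injective ss as bs e₂)

isCharCode : ℕ → ℕ → ℕ
isCharCode k m = orN (notN m) (ltN (hd m) (suc k))

isStringCode : ℕ → ℕ → ℕ
isStringCode k = allSuffixes (isCharCode k)

isStringCodeᶜ : ∀ k → Computable 1 (uncurry₁ (isStringCode k))
isStringCodeᶜ k =
  allSuffixesᶜ (fromExpr (call₂ orᶜ (call₁ notᶜ x₀) (call₂ ltᶜ (call₁ hdᶜ x₀) (lit (suc k)))) λ { (_ ∷ []) → refl })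

isStringCode-elim : ∀ k m → Holds (isStringCode k m) → Σ (List (Fin (suc k))) λ w → codeStr w ≡ m
isStringCode-elim k m t with listCode-surjective m
... | L , refl = let w , e = go L (allSuffixes-elim (isCharCode k) L t) in w , trans (codeStr-listCode w) (cong listCode e)
  where
  go : ∀ M → (∀ p → p < length M → Holds (isCharCode k (listCode (drop p M)))) →
       Σ (List (Fin (suc k))) λ w → map toℕ w ≡ M
  go [] _ = [] , refl
  go (x ∷ R) h with or-elim _ _ (h 0 (s≤s z≤n))
  ... | inj₁ t₀ = ⊥-elim (1+n≢0 (not-elim _ t₀))
  ... | inj₂ t₁ = let w , e = go R (λ p lt → h (suc p) (s≤s lt))
                      x<k = subst (_< suc k) (hd-cons x (listCode R)) (lt-elim _ _ t₁)
                  in fromℕ< x<k ∷ w , cong₂ _∷_ (toℕ-fromℕ< x<k) e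

isStringCode-intro : ∀ k (w : List (Fin (suc k))) → Holds (isStringCode k (codeStr w))
isStringCode-intro k w = subst (λ m → Holds (isStringCode k m)) (sym (codeStr-listCode w))
                               (allSuffixes-intro (isCharCode k) L suffixOk)
  where
  L = map toℕ w
  suffixOk : ∀ p → Holds (isCharCode k (listCode (drop p L)))
  suffixOk p with drop p L in eq
  ... | [] = or-introˡ _ not-intro
  ... | x ∷ R with ∈-map⁻ toℕ (drop-∷⇒∈ p L eq)
  ...   | c , _ , refl = or-introʳ _ (subst (λ z → Holds (ltN z (suc k))) (sym (hd-cons x (listCode R))) (lt-intro (toℕ<n c)))

isSortCode : ℕ → Sort → ℕ → ℕ
isSortCode k Nat m = 1
isSortCode k Int m = 1
isSortCode k Str m = isStringCode k m

isSortCodeᶜ : ∀ k s → Computable 1 (uncurry₁ (isSortCode k s))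
isSortCodeᶜ k Nat = fromExpr (lit 1) λ { (_ ∷ []) → refl }
isSortCodeᶜ k Int = fromExpr (lit 1) λ { (_ ∷ []) → refl }
isSortCodeᶜ k Str = isStringCodeᶜ k

isCode : ℕ → List Sort → ℕ → ℕ
isCode k [] m = eqN m 0
isCode k (s ∷ ss) m = andN (isSortCode k s (fstP m)) (isCode k ss (sndP m))

isCodeᶜ : ∀ k X → Computable 1 (uncurry₁ (isCode k X))
isCodeᶜ k [] = fromExpr (call₂ eqᶜ x₀ (lit 0)) λ { (_ ∷ []) → refl }
isCodeᶜ k (s ∷ ss) = fromExpr (call₂ andᶜ (call₁ (isSortCodeᶜ k s) (call₁ fstᶜ x₀)) (call₁ (isCodeᶜ k ss) (call₁ sndᶜ x₀)))
                              λ { (_ ∷ []) → refl }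

isSortCode-elim : ∀ k s m → Holds (isSortCode k s m) → Σ (⟦ s ⟧ k) λ a → codeSort s a ≡ m
isSortCode-elim k Nat m t = m , refl
isSortCode-elim k Int m t = decodeℤ m , codeℤ-decodeℤ m
isSortCode-elim k Str m t = isStringCode-elim k m t

isSortCode-intro : ∀ k s (a : ⟦ s ⟧ k) → Holds (isSortCode k s (codeSort s a))
isSortCode-intro k Nat a = holds
isSortCode-intro k Int a = holds
isSortCode-intro k Str a = isStringCode-intro k a

isCode-elim : ∀ k X m → Holds (isCode k X m) → Σ (El k X) λ x → code X x ≡ m
isCode-elim k [] m t = tt , sym (eq-elim m 0 t)
isCode-elim k (s ∷ ss) m t with and-elim _ _ t
... | t₁ , t₂ with isSortCode-elim k s _ t₁ | isCode-elim k ss _ t₂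
... | a , ea | as , eas = (a , as) , trans (cong₂ pair ea eas) (pair-unpair m)

isCode-intro : ∀ k X (x : El k X) → Holds (isCode k X (code X x))
isCode-intro k [] tt = eq-refl 0
isCode-intro k (s ∷ ss) (a , as) =
  and-intro (subst (λ z → Holds (isSortCode k s z)) (sym (fst-pair (codeSort s a) (code ss as))) (isSortCode-intro k s a))
            (subst (λ z → Holds (isCode k ss z)) (sym (snd-pair (codeSort s a) (code ss as))) (isCode-intro k ss as))

inhabited : ExcludedMiddle 0ℓ → ∀ {A : Set} (P : A → Set) → Infinite P → Σ A P
inhabited lem P inf with lem {Σ _ P}
... | yes p = p
... | no ¬p = ⊥-elim (inf ([] , λ x px → ⊥-elim (¬p (x , px))))

infinite-range : ∀ {A : Set} {P : A → Set} (f : ℕ → A) → (∀ m n → m < n → f m ≢ f n) → (∀ n → P (f n)) → Infinite P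
infinite-range f distinct inP (F , cover) =
  let a , b , a<b , same = pigeonhole (n<1+n (length F)) position
  in distinct (toℕ a) (toℕ b) a<b
       (trans (lookup-index (f∈F a)) (trans (cong (Data.List.lookup F) same) (sym (lookup-index (f∈F b)))))
  where
  f∈F : (a : Fin (suc (length F))) → f (toℕ a) ∈ F
  f∈F a = cover (f (toℕ a)) (inP (toℕ a))
  position : Fin (suc (length F)) → Fin (length F)
  position a = index (f∈F a)

-- A partial recursive selector: given a total  t : i ↦ j,  select t i  searches for a code of an element
-- of  W_j  together with a certificate that it belongs there.
module Selection (k : ℕ) (X : List Sort) where

  isWitness : ℕ → ℕ → ℕ
  isWitness j s = andN (isCode k X (fstP s)) (certifies j (cons (fstP s) 0) (sndP s))

  noWitnessᶜ : Computable 2 (uncurry₂ (λ s j → notN (isWitness j s)))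
  noWitnessᶜ = fromExpr (call₁ notᶜ (call₂ andᶜ (call₁ (isCodeᶜ k X) (call₁ fstᶜ x₀))
                                                (call₃ certifiesᶜ x₁ (call₂ consᶜ (call₁ fstᶜ x₀) (lit 0)) (call₁ sndᶜ x₀))))
                        λ { (_ ∷ _ ∷ []) → refl }

  isWitness-intro : ∀ j x cert → Holds (certifies j (cons (code X x) 0) cert) → Holds (isWitness j (pair (code X x) cert))
  isWitness-intro j x cert t =
    subst₂ (λ a b → Holds (andN (isCode k X a) (certifies j (cons a 0) b)))
           (sym (fst-pair (code X x) cert)) (sym (snd-pair (code X x) cert)) (and-intro (isCode-intro k X x) t)

  search : PR 1 → PR 2
  search t = comp (term noWitnessᶜ) (proj zero ∷ comp t (proj (suc zero) ∷ []) ∷ [])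

  select : PR 1 → PR 1
  select t = comp (term fstᶜ) (mu (search t) ∷ [])

  search-eval : ∀ {t i j} → Eval t (i ∷ []) j → ∀ s → Eval (search t) (s ∷ i ∷ []) (notN (isWitness j s))
  search-eval {j = j} evj s = ev-comp (ev-proj ∷ ev-comp (ev-proj ∷ []) evj ∷ []) (evaluates noWitnessᶜ (s ∷ j ∷ []))

  search-root : ∀ {t i j y} → Eval t (i ∷ []) j → Eval (mu (search t)) (i ∷ []) y → Holds (isWitness j y)
  search-root {t} {i} {j} evj evs = notN-≡0 (mu-root (search t) (λ s → notN (isWitness j s)) (i ∷ []) (search-eval evj) evs)

  isWitness-elim : ∀ j s → Holds (isWitness j s) → Σ (El k X) λ x → code X x ≡ fstP s × W k X j x
  isWitness-elim j s h =
    let tcode , tcert = and-elim _ _ h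
        x , ex = isCode-elim k X (fstP s) tcode
    in x , ex , subst (Halts j) (sym ex) (certificate→halts j (fstP s) (sndP s) tcert)

  select-sound : ∀ {t i j m} → Eval t (i ∷ []) j → Eval (select t) (i ∷ []) m → Σ (El k X) λ x → code X x ≡ m × W k X j x
  select-sound {j = j} evj (ev-comp {ys = y ∷ []} (evs ∷ []) evf) =
    let x , ex , wx = isWitness-elim j y (search-root evj evs)
    in x , trans ex (eval-deterministic (evaluates fstᶜ (y ∷ [])) evf) , wx

  select-halts : ∀ {t i j} → Eval t (i ∷ []) j → ∀ x → W k X j x → Σ ℕ λ m → Eval (select t) (i ∷ []) m
  select-halts {t} {i} {j} evj x wx =
    let cert , tcert = halts→certificate {j} {code X x} wx
        y , evy , _ = mu-halts (search t) (λ s → notN (isWitness j s)) (i ∷ []) (search-eval evj)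
                               (pair (code X x) cert) (notN-holds (isWitness-intro j x cert tcert))
    in fstP y , ev-comp (evy ∷ []) (evaluates fstᶜ (y ∷ []))

dense⇒immune : ExcludedMiddle 0ℓ → ∀ k X (Z : El k X → Set) →
               Infinite Z → ConstructivelyDense k X (complement Z) → ConstructivelyImmune k X Z
dense⇒immune lem k X Z infZ (t , total , dense) = infZ , select t , avoids
  where
  open Selection k X
  avoids : ∀ i → Infinite (W k X i) → Σ (El k X) λ x → Eval (select t) (i ∷ []) (code X x) × W k X i x × ¬ Z x
  avoids i infWi =
    let j , evj = total i
        infWj , Wj⊆Wi∖Z = dense i infWi j evj
        a , wa = inhabited lem (W k X j) infWj
        m , evm = select-halts evj a wa
        x , x≡m , wx = select-sound evj evm
    in x , subst (Eval (select t) (i ∷ [])) (sym x≡m) evm , proj₂ (Wj⊆Wi∖Z x wx) , proj₁ (Wj⊆Wi∖Z x wx)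

-- pairᵒ is pair made opaque, so that codes of concrete terms built with it are compared
-- symbolically by the type checker instead of being computed.
opaque
  pairᵒ : ℕ → ℕ → ℕ
  pairᵒ = pair
  pairᵒ-def : ∀ a b → pairᵒ a b ≡ pair a b
  pairᵒ-def a b = refl
  pairᵒᶜ : Computable 2 (uncurry₂ pairᵒ)
  pairᵒᶜ = pairᶜ

mutual
  encodeᵒ : ∀ {n} → PR n → ℕ
  encodeᵒ (zer {n})           = pairᵒ 0 n
  encodeᵒ succ                = pairᵒ 1 0
  encodeᵒ (proj {n} i)        = pairᵒ 2 (pairᵒ n (toℕ i))
  encodeᵒ (comp {k} {n} f gs) = pairᵒ 3 (pairᵒ (pairᵒ k n) (pairᵒ (encodeᵒ f) (encodeVecᵒ gs)))
  encodeᵒ (prec {n} f g)      = pairᵒ 4 (pairᵒ n (pairᵒ (encodeᵒ f) (encodeᵒ g)))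
  encodeᵒ (mu {n} f)          = pairᵒ 5 (pairᵒ n (encodeᵒ f))

  encodeVecᵒ : ∀ {k n} → Vec (PR n) k → ℕ
  encodeVecᵒ []       = 0
  encodeVecᵒ (g ∷ gs) = suc (pairᵒ (encodeᵒ g) (encodeVecᵒ gs))

mutual
  encodeᵒ-correct : ∀ {n} (t : PR n) → encodeᵒ t ≡ encode t
  encodeᵒ-correct (zer {n}) = pairᵒ-def 0 n
  encodeᵒ-correct succ = pairᵒ-def 1 0
  encodeᵒ-correct (proj {n} i) = trans (cong (pairᵒ 2) (pairᵒ-def n (toℕ i))) (pairᵒ-def 2 _)
  encodeᵒ-correct (comp {k} {n} f gs) =
    trans (cong₂ (λ a b → pairᵒ 3 (pairᵒ a b)) (pairᵒ-def k n)
                 (trans (cong₂ pairᵒ (encodeᵒ-correct f) (encodeVecᵒ-correct gs)) (pairᵒ-def _ _)))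
          (trans (cong (pairᵒ 3) (pairᵒ-def _ _)) (pairᵒ-def 3 _))
  encodeᵒ-correct (prec {n} f g) =
    trans (cong (λ a → pairᵒ 4 (pairᵒ n a)) (trans (cong₂ pairᵒ (encodeᵒ-correct f) (encodeᵒ-correct g)) (pairᵒ-def _ _)))
          (trans (cong (pairᵒ 4) (pairᵒ-def n _)) (pairᵒ-def 4 _))
  encodeᵒ-correct (mu {n} f) =
    trans (cong (λ a → pairᵒ 5 (pairᵒ n a)) (encodeᵒ-correct f)) (trans (cong (pairᵒ 5) (pairᵒ-def n _)) (pairᵒ-def 5 _))

  encodeVecᵒ-correct : ∀ {k n} (gs : Vec (PR n) k) → encodeVecᵒ gs ≡ encodeVec gs
  encodeVecᵒ-correct [] = refl
  encodeVecᵒ-correct (g ∷ gs) = cong suc (trans (cong₂ pairᵒ (encodeᵒ-correct g) (encodeVecᵒ-correct gs)) (pairᵒ-def _ _))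

numeralCode : ℕ → ℕ → ℕ
numeralCode a zero = pairᵒ 0 a
numeralCode a (suc c) = pairᵒ 3 (pairᵒ (pairᵒ 1 a) (pairᵒ (pairᵒ 1 0) (suc (pairᵒ (numeralCode a c) 0))))

numeralCode-correct : ∀ a c → numeralCode a c ≡ encodeᵒ (numeral {a} c)
numeralCode-correct a zero = refl
numeralCode-correct a (suc c) = cong (λ z → pairᵒ 3 (pairᵒ (pairᵒ 1 a) (pairᵒ (pairᵒ 1 0) (suc (pairᵒ z 0))))) (numeralCode-correct a c)

numeralCodeᶜ : ∀ a → Computable 1 (uncurry₁ (numeralCode a))
numeralCodeᶜ a =
  resp-≗ (primRecᶜ (fromExpr {F = λ _ → pairᵒ 0 a} (call₂ pairᵒᶜ (lit 0) (lit a)) λ { [] → refl })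
                   (fromExpr {F = uncurry₂ (λ _ r → step r)}
                             (call₂ pairᵒᶜ (lit 3) (call₂ pairᵒᶜ (call₂ pairᵒᶜ (lit 1) (lit a))
                                                   (call₂ pairᵒᶜ (call₂ pairᵒᶜ (lit 1) (lit 0)) (call₁ sucᶜ (call₂ pairᵒᶜ x₁ (lit 0))))))
                             λ { (_ ∷ _ ∷ []) → refl }))
         go
  where
  step : ℕ → ℕ
  step r = pairᵒ 3 (pairᵒ (pairᵒ 1 a) (pairᵒ (pairᵒ 1 0) (suc (pairᵒ r 0))))
  go : ∀ xs → _ ≡ uncurry₁ (numeralCode a) xs
  go (zero ∷ []) = refl
  go (suc c ∷ []) = cong step (go (c ∷ []))

notInHalts : ℕ → ℕ → ℕ → ℕ → ℕ
notInHalts cert m i L = andN (notN (mem m L)) (certifies i (cons m 0) cert)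

noRemovalWitnessᶜ : Computable 4 (uncurry₄ (λ cert m i L → notN (notInHalts cert m i L)))
noRemovalWitnessᶜ = fromExpr (call₁ notᶜ (call₂ andᶜ (call₁ notᶜ (call₂ memᶜ x₁ x₃)) (call₃ certifiesᶜ x₂ (call₂ consᶜ x₁ (lit 0)) x₀)))
                             λ { (_ ∷ _ ∷ _ ∷ _ ∷ []) → refl }

-- removeTerm i L  halts on  m  exactly when  m ∉ L  and  φ_i(m)  halts.
removeSearch : ℕ → ℕ → PR 2
removeSearch i L = comp (term noRemovalWitnessᶜ) (proj zero ∷ proj (suc zero) ∷ numeral i ∷ numeral L ∷ [])

removeTerm : ℕ → ℕ → PR 1
removeTerm i L = mu (removeSearch i L)

removeSearch-eval : ∀ i L cert m → Eval (removeSearch i L) (cert ∷ m ∷ []) (notN (notInHalts cert m i L))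
removeSearch-eval i L cert m =
  ev-comp (ev-proj ∷ ev-proj ∷ numeral-eval i _ ∷ numeral-eval L _ ∷ []) (evaluates noRemovalWitnessᶜ _)

removeIndex : ℕ → ℕ → ℕ
removeIndex i L = encodeᵒ (removeTerm i L)

-- The s-m-n step: the index of  removeTerm i L  is a primitive recursive function of  i  and  L.
-- shape spells out  encodeᵒ (removeTerm i L)  with the codes of the numerals for i and L abstracted.
removeIndexᶜ : Computable 2 (uncurry₂ removeIndex)
removeIndexᶜ = fromExpr expr λ { (i ∷ L ∷ []) → cong₂ shape (numeralCode-correct 2 i) (numeralCode-correct 2 L) }
  where
  shape : ℕ → ℕ → ℕ
  shape a b = pairᵒ 5 (pairᵒ 1 (pairᵒ 3 (pairᵒ (pairᵒ 4 2) (pairᵒ (encodeᵒ (term noRemovalWitnessᶜ))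
               (suc (pairᵒ (encodeᵒ (proj {2} zero)) (suc (pairᵒ (encodeᵒ (proj {2} (suc zero)))
               (suc (pairᵒ a (suc (pairᵒ b 0))))))))))))
  expr : Expr 2
  expr = call₂ pairᵒᶜ (lit 5) (call₂ pairᵒᶜ (lit 1) (call₂ pairᵒᶜ (lit 3) (call₂ pairᵒᶜ (call₂ pairᵒᶜ (lit 4) (lit 2))
           (call₂ pairᵒᶜ (lit (encodeᵒ (term noRemovalWitnessᶜ)))
           (call₁ sucᶜ (call₂ pairᵒᶜ (lit (encodeᵒ (proj {2} zero))) (call₁ sucᶜ (call₂ pairᵒᶜ (lit (encodeᵒ (proj {2} (suc zero))))
           (call₁ sucᶜ (call₂ pairᵒᶜ (call₁ (numeralCodeᶜ 2) x₀) (call₁ sucᶜ (call₂ pairᵒᶜ (call₁ (numeralCodeᶜ 2) x₁) (lit 0)))))))))))))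

module Removal (k : ℕ) (X : List Sort) where

  notN-mem : ∀ m L → m ∉ L → Holds (notN (mem m (listCode L)))
  notN-mem m L m∉L with holds? (mem m (listCode L))
  ... | inj₁ e = subst (λ z → Holds (notN z)) (sym e) not-intro
  ... | inj₂ t = ⊥-elim (m∉L (mem-elim m L t))

  removeIndex-sound : ∀ i L x → W k X (removeIndex i (listCode L)) x → code X x ∉ L × W k X i x
  removeIndex-sound i L x (t , et , cert , ev) =
    (λ x∈L → ¬Holds-0 (subst Holds (not-elim _ (proj₁ found)) (mem-intro _ L x∈L))) ,
    certificate→halts i (code X x) cert (proj₂ found)
    where
    t≡ : t ≡ removeTerm i (listCode L)
    t≡ = encode-injective t _ (trans et (encodeᵒ-correct (removeTerm i (listCode L))))
    found : Holds (notN (mem (code X x) (listCode L))) × Holds (certifies i (cons (code X x) 0) cert)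
    found = and-elim _ _ (notN-≡0 (mu-root (removeSearch i (listCode L)) _ (code X x ∷ [])
                                           (λ c → removeSearch-eval i (listCode L) c (code X x))
                                           (subst (λ u → Eval u (code X x ∷ []) cert) t≡ ev)))

  removeIndex-complete : ∀ i L x → code X x ∉ L → W k X i x → W k X (removeIndex i (listCode L)) x
  removeIndex-complete i L x x∉L wx =
    let cert , tcert = halts→certificate {i} {code X x} wx
        y , evy , _ = mu-halts (removeSearch i (listCode L)) _ (code X x ∷ []) (λ c → removeSearch-eval i (listCode L) c (code X x))
                               cert (notN-holds (and-intro (notN-mem (code X x) L x∉L) tcert))
    in removeTerm i (listCode L) , sym (encodeᵒ-correct (removeTerm i (listCode L))) , y , evy

  code-∈-map : ∀ x (Ls : List (El k X)) → code X x ∈ map (code X) Ls → x ∈ Ls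
  code-∈-map x Ls x∈ with ∈-map⁻ (code X) x∈
  ... | z , z∈Ls , e = subst (_∈ Ls) (sym (code-injective X x z e)) z∈Ls

  removeIndex-infinite : ExcludedMiddle 0ℓ → ∀ i → Infinite (W k X i) → ∀ Ls →
                         Infinite (W k X (removeIndex i (listCode (map (code X) Ls))))
  removeIndex-infinite lem i inf Ls (F , cover) = inf (F ++ Ls , cover′)
    where
    cover′ : ∀ x → W k X i x → x ∈ F ++ Ls
    cover′ x wx with lem {code X x ∈ map (code X) Ls}
    ... | yes x∈ = ∈-++⁺ʳ F (code-∈-map x Ls x∈)
    ... | no x∉ = ∈-++⁺ˡ (cover x (removeIndex-complete i (map (code X) Ls) x x∉ wx))

neqᶜ : Computable 2 (uncurry₂ (λ a b → notN (eqN a b)))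
neqᶜ = fromExpr (call₁ notᶜ (call₂ eqᶜ x₀ x₁)) λ { (_ ∷ _ ∷ []) → refl }

-- From the immunity function φ: x_n = φ(removeIndex i [x_{n-1}, …, x_0]) are distinct elements of W_i \ Z,
-- and λ(i) is the index of the set {x_n}, the domain of a μ-search for n with x_n = m.
module ImmuneToDense (lem : ExcludedMiddle 0ℓ) (k : ℕ) (X : List Sort) (Z : El k X → Set) (tφ : PR 1)
       (avoids : ∀ i → Infinite (W k X i) → Σ (El k X) λ x → Eval tφ (i ∷ []) (code X x) × W k X i x × ¬ Z x) where

  open Removal k X

  codeList : List (El k X) → ℕ
  codeList Ls = listCode (map (code X) Ls)

  step : PR 3
  step = comp (term consᶜ) (comp tφ (comp (term removeIndexᶜ) (proj (suc (suc zero)) ∷ proj (suc zero) ∷ []) ∷ []) ∷ proj (suc zero) ∷ [])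

  prefixes : PR 2
  prefixes = prec zer step

  next : PR 2
  next = comp succ (proj zero ∷ [])

  misses : ℕ → PR 2
  misses i = comp (term neqᶜ) (comp (term hdᶜ) (comp prefixes (next ∷ numeral i ∷ []) ∷ []) ∷ proj (suc zero) ∷ [])

  enumTerm : ℕ → PR 1
  enumTerm i = mu (misses i)

  enumIndexᶜ : Computable 1 (uncurry₁ (λ i → encodeᵒ (enumTerm i)))
  enumIndexᶜ = fromExpr expr λ { (i ∷ []) → cong shape (numeralCode-correct 2 i) }
    where
    shape : ℕ → ℕ
    shape a = pairᵒ 5 (pairᵒ 1 (pairᵒ 3 (pairᵒ (pairᵒ 2 2) (pairᵒ (encodeᵒ (term neqᶜ)) (suc (pairᵒ (pairᵒ 3 (pairᵒ (pairᵒ 1 2)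
      (pairᵒ (encodeᵒ (term hdᶜ)) (suc (pairᵒ (pairᵒ 3 (pairᵒ (pairᵒ 2 2) (pairᵒ (encodeᵒ prefixes) (suc (pairᵒ (encodeᵒ next)
      (suc (pairᵒ a 0))))))) 0))))) (suc (pairᵒ (encodeᵒ (proj {2} (suc zero))) 0))))))))
    expr : Expr 1
    expr = call₂ pairᵒᶜ (lit 5) (call₂ pairᵒᶜ (lit 1) (call₂ pairᵒᶜ (lit 3) (call₂ pairᵒᶜ (call₂ pairᵒᶜ (lit 2) (lit 2))
      (call₂ pairᵒᶜ (lit (encodeᵒ (term neqᶜ))) (call₁ sucᶜ (call₂ pairᵒᶜ (call₂ pairᵒᶜ (lit 3) (call₂ pairᵒᶜ (call₂ pairᵒᶜ (lit 1) (lit 2))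
      (call₂ pairᵒᶜ (lit (encodeᵒ (term hdᶜ))) (call₁ sucᶜ (call₂ pairᵒᶜ (call₂ pairᵒᶜ (lit 3) (call₂ pairᵒᶜ (call₂ pairᵒᶜ (lit 2) (lit 2))
      (call₂ pairᵒᶜ (lit (encodeᵒ prefixes)) (call₁ sucᶜ (call₂ pairᵒᶜ (lit (encodeᵒ next))
      (call₁ sucᶜ (call₂ pairᵒᶜ (call₁ (numeralCodeᶜ 2) x₀) (lit 0)))))))) (lit 0))))))
      (call₁ sucᶜ (call₂ pairᵒᶜ (lit (encodeᵒ (proj {2} (suc zero)))) (lit 0)))))))))

  module Enumeration (i : ℕ) (infWi : Infinite (W k X i)) where

    avoiding : ∀ Ls → Σ (El k X) λ x → Eval tφ (removeIndex i (codeList Ls) ∷ []) (code X x) ×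
                                      W k X (removeIndex i (codeList Ls)) x × ¬ Z x
    avoiding Ls = avoids (removeIndex i (codeList Ls)) (removeIndex-infinite lem i infWi Ls)

    prefix : ℕ → List (El k X)
    prefix zero = []
    prefix (suc n) = proj₁ (avoiding (prefix n)) ∷ prefix n

    element : ℕ → El k X
    element n = proj₁ (avoiding (prefix n))

    prefixes-eval : ∀ n → Eval prefixes (n ∷ i ∷ []) (codeList (prefix n))
    prefixes-eval zero = ev-prec0 ev-zer
    prefixes-eval (suc n) = ev-precS (prefixes-eval n)
      (ev-comp (ev-comp (ev-comp (ev-proj ∷ ev-proj ∷ []) (evaluates removeIndexᶜ (i ∷ codeList (prefix n) ∷ [])) ∷ [])
                        (proj₁ (proj₂ (avoiding (prefix n)))) ∷ ev-proj ∷ [])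
               (evaluates consᶜ _))

    misses-eval : ∀ n m → Eval (misses i) (n ∷ m ∷ []) (notN (eqN (hd (codeList (prefix (suc n)))) m))
    misses-eval n m = ev-comp (ev-comp (ev-comp (ev-comp (ev-proj ∷ []) ev-succ ∷ numeral-eval i _ ∷ []) (prefixes-eval (suc n)) ∷ [])
                                       (evaluates hdᶜ _) ∷ ev-proj ∷ [])
                              (evaluates neqᶜ _)

    hd-prefix : ∀ n → hd (codeList (prefix (suc n))) ≡ code X (element n)
    hd-prefix n = hd-cons (code X (element n)) (codeList (prefix n))

    element-fresh : ∀ n → code X (element n) ∉ map (code X) (prefix n) × W k X i (element n)
    element-fresh n = removeIndex-sound i (map (code X) (prefix n)) (element n) (proj₁ (proj₂ (proj₂ (avoiding (prefix n)))))

    element-∉Z : ∀ n → ¬ Z (element n)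
    element-∉Z n = proj₂ (proj₂ (proj₂ (avoiding (prefix n))))

    element-∈prefix : ∀ m n → m < n → code X (element m) ∈ map (code X) (prefix n)
    element-∈prefix m (suc n) (s≤s m≤n) with m≤n⇒m<n∨m≡n m≤n
    ... | inj₁ m<n = there (element-∈prefix m n m<n)
    ... | inj₂ refl = here refl

    elements-distinct : ∀ m n → m < n → element m ≢ element n
    elements-distinct m n m<n e =
      proj₁ (element-fresh n) (subst (λ z → code X z ∈ map (code X) (prefix n)) e (element-∈prefix m n m<n))

    enum-complete : ∀ n → W k X (encodeᵒ (enumTerm i)) (element n)
    enum-complete n =
      let y , evy , _ = mu-halts (misses i) _ (code X (element n) ∷ []) (λ n′ → misses-eval n′ (code X (element n))) n
                                 (notN-holds (eq-intro (hd-prefix n)))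
      in enumTerm i , sym (encodeᵒ-correct (enumTerm i)) , y , evy

    enum-sound : ∀ x → W k X (encodeᵒ (enumTerm i)) x → Σ ℕ λ n → element n ≡ x
    enum-sound x (t , et , n , ev) = n , code-injective X (element n) x (trans (sym (hd-prefix n)) (eq-elim _ _ (notN-≡0 root)))
      where
      t≡ : t ≡ enumTerm i
      t≡ = encode-injective t (enumTerm i) (trans et (encodeᵒ-correct (enumTerm i)))
      root : notN (eqN (hd (codeList (prefix (suc n)))) (code X x)) ≡ 0
      root = mu-root (misses i) _ (code X x ∷ []) (λ n′ → misses-eval n′ (code X x))
                     (subst (λ u → Eval u (code X x ∷ []) n) t≡ ev)

  dense : ConstructivelyDense k X (complement Z)
  dense = term enumIndexᶜ , (λ i → _ , evaluates enumIndexᶜ (i ∷ [])) , enumerates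
    where
    enumerates : ∀ i → Infinite (W k X i) → ∀ j → Eval (term enumIndexᶜ) (i ∷ []) j →
                 Infinite (W k X j) × (∀ x → W k X j x → complement Z x × W k X i x)
    enumerates i infWi j evj =
      subst (λ j → Infinite (W k X j)) j≡ (infinite-range element elements-distinct enum-complete) ,
      λ x wx → let n , e = enum-sound x (subst (λ j → W k X j x) (sym j≡) wx)
               in subst (complement Z) e (element-∉Z n) , subst (W k X i) e (proj₂ (element-fresh n))
      where
      open Enumeration i infWi
      j≡ : encodeᵒ (enumTerm i) ≡ j
      j≡ = eval-deterministic (evaluates enumIndexᶜ (i ∷ [])) evj

immune⇒dense : ExcludedMiddle 0ℓ → ∀ k X (Z : El k X → Set) → ConstructivelyImmune k X Z → ConstructivelyDense k X (complement Z)
immune⇒dense lem k X Z (_ , tφ , avoids) = ImmuneToDense.dense lem k X Z tφ avoids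

propositionp : ExcludedMiddle 0ℓ → (k : ℕ) (X : List Sort) (Z : El k X → Set) →
    ConstructivelyImmune k X Z ⇔ (Infinite Z × ConstructivelyDense k X (complement Z))
propositionp lem k X Z = mk⇔ (λ immune → proj₁ immune , immune⇒dense lem k X Z immune)
                             (λ (infZ , dense) → dense⇒immune lem k X Z infZ dense)
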